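{- Let $\Sigma$ be a finite alphabet and let $S$ be a set of unranked trees over $\Sigma$ definable by an MSO sentence that is sibling-order-invariant over the class of all unranked trees over $\Sigma$. Then there is a deterministic $\lessdot$-invariant tree automaton $\mathcal{N}$ over $\Sigma$ such that $S$ is exactly the set of unranked trees $T$ for which some sibling-ordered extension $(T,\lessdot)$ is accepted by $\mathcal{N}$ (equivalently, for which every sibling-ordered extension $(T,\lessdot)$ is accepted by $\mathcal{N}$).
   Context: An unranked tree domain $D$ is a finite, prefix-closed set of words over the positive integers such that $s\cdot i\in D$ implies $s\cdot j\in D$ for all $1\le j<i$; the empty word $\varepsilon$ is the root. An unranked tree over $\Sigma$ is a structure $T=(D,\prec,(P_a)_{a\in\Sigma})$ with $\prec$ the descendant relation ($s\prec s\cdot s'$ whenever $s\cdot s'\in D$, $s'$ nonempty) and the $P_a$ partitioning $D$ (labels). A sibling order on $T$ is a relation $\lessdot$ on $D$ such that $s'\lessdot s''$ implies $s'=s\cdot i,s''=s\cdot j$ for some $s$ and distinct $i,j$, and $\lessdot$ linearly orders the children of each node; $(T,\lessdot)$ is a sibling-ordered extension of $T$. An MSO sentence $\phi$ over the tree vocabulary plus a binary symbol $\lessdot$ is sibling-order-invariant if for every tree $T$ and any two sibling orders $\lessdot_1,\lessdot_2$ on $T$, $(T,\lessdot_1)\models\phi$ iff $(T,\lessdot_2)\models\phi$; it defines the set of trees $T$ with $(T,\lessdot)\models\phi$ for some (equivalently all) sibling orders. A tree automaton is $\mathcal{N}=(\Sigma,Q,F,\delta)$ with finite state set $Q$, final states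 $F\subseteq Q$, and $\delta:Q\times\Sigma\to 2^{Q^*}$ with each $\delta(q,a)$ a regular language over $Q$. A run on $(T,\lessdot)$ is $\rho:D\to Q$ such that for each node $s$ labeled $a$ with children $s_1\lessdot\cdots\lessdot s_n$, $\rho(s_1)\cdots\rho(s_n)\in\delta(\rho(s),a)$ (for a leaf, the empty word must be in $\delta(\rho(s),a)$); $(T,\lessdot)$ is accepted if some run has $\rho(\varepsilon)\in F$. $\mathcal{N}$ is deterministic if for all $q\neq q'$ and $a\in\Sigma$, $\delta(q,a)\cap\delta(q',a)=\emptyset$. $\mathcal{N}$ is $\lessdot$-invariant if for all $q,a$, every permutation of a word in $\delta(q,a)$ is also in $\delta(q,a)$. -}

module Defs where

open import Data.Nat using (ℕ; suc)
open import Data.Fin using (Fin; toℕ)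
open import Data.Bool using (Bool; true)
open import Data.List using (List; []; _∷_; [_]; _++_; length; lookup; map; foldl)
open import Data.List.Relation.Unary.Any using (Any)
open import Data.List.Relation.Unary.Linked using (Linked)
open import Data.List.Relation.Binary.Permutation.Propositional using (_↭_)
open import Data.Product using (Σ; ∃; ∃₂; _×_; _,_; proj₁)
open import Data.Sum using (_⊎_)
open import Data.Empty using (⊥)
open import Relation.Nullary using (¬_)
open import Relation.Binary using (Decidable)
open import Relation.Binary.PropositionalEquality using (_≡_; _≢_)
open import Level using (Level) renaming (suc to lsuc; zero to lzero)

-- Unranked trees over the alphabet Σ = Fin k.
-- A tree is given by its (unique) rose-tree presentation; its domain D
-- is the set of words w with w ∈D t (children numbered 1,2,3,…).

data Tree (k : ℕ) : Set where
  node : Fin k → List (Tree k) → Tree k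

data _∈D_ {k : ℕ} : List ℕ → Tree k → Set where
  root : ∀ {a ts} → [] ∈D node a ts
  step : ∀ {a ts w} (i : Fin (length ts)) →
         w ∈D lookup ts i → (suc (toℕ i) ∷ w) ∈D node a ts

Pos : ∀ {k} → Tree k → Set
Pos t = Σ (List ℕ) (λ w → w ∈D t)

rootPos : ∀ {k} (t : Tree k) → Pos t
rootPos (node a ts) = [] , root

labelAt : ∀ {k} {w : List ℕ} {t : Tree k} → w ∈D t → Fin k
labelAt (root {a}) = a
labelAt (step i p) = labelAt p

label : ∀ {k} {t : Tree k} → Pos t → Fin k
label (w , p) = labelAt p

_≺_ : ∀ {k} {t : Tree k} → Pos t → Pos t → Set
x ≺ y = ∃₂ λ (i : ℕ) (r : List ℕ) → proj₁ y ≡ proj₁ x ++ (i ∷ r)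

IsChild : ∀ {k} {t : Tree k} → Pos t → Pos t → Set
IsChild s y = ∃ λ (i : ℕ) → proj₁ y ≡ proj₁ s ++ [ i ]

record SiblingOrder {k : ℕ} (t : Tree k) : Set₁ where
  field
    _⋖_      : Pos t → Pos t → Set
    ⋖-dec    : Decidable _⋖_
    siblings : ∀ x y → x ⋖ y →
               Σ (List ℕ) λ s → ∃₂ λ (i j : ℕ) →
                 (proj₁ x ≡ s ++ [ i ]) × (proj₁ y ≡ s ++ [ j ]) × (i ≢ j)
    trans    : ∀ x y z → x ⋖ y → y ⋖ z → x ⋖ z
    total    : ∀ s x y → IsChild s x → IsChild s y →
               proj₁ x ≢ proj₁ y → (x ⋖ y) ⊎ (y ⋖ x)

-- MSO over the vocabulary (≺, (P_a)_a, ⋖).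
-- Formula k n m : n first-order and m second-order free variables.

data Formula (k : ℕ) : ℕ → ℕ → Set where
  lab  : ∀ {n m} → Fin k → Fin n → Formula k n m
  desc : ∀ {n m} → Fin n → Fin n → Formula k n m
  sib  : ∀ {n m} → Fin n → Fin n → Formula k n m
  eq   : ∀ {n m} → Fin n → Fin n → Formula k n m
  mem  : ∀ {n m} → Fin n → Fin m → Formula k n m
  neg  : ∀ {n m} → Formula k n m → Formula k n m
  conj : ∀ {n m} → Formula k n m → Formula k n m → Formula k n m
  ex₁  : ∀ {n m} → Formula k (suc n) m → Formula k n m
  ex₂  : ∀ {n m} → Formula k n (suc m) → Formula k n m

Sentence : ℕ → Set
Sentence k = Formula k 0 0

extend : ∀ {n} {A : Set} → A → (Fin n → A) → Fin (suc n) → A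
extend a ρ Fin.zero = a
extend a ρ (Fin.suc i) = ρ i

Sat : ∀ {k n m} (t : Tree k) → SiblingOrder t → Formula k n m →
      (Fin n → Pos t) → (Fin m → (Pos t → Bool)) → Set
Sat t so (lab a x)  ρ σ = label (ρ x) ≡ a
Sat t so (desc x y) ρ σ = ρ x ≺ ρ y
Sat t so (sib x y)  ρ σ = SiblingOrder._⋖_ so (ρ x) (ρ y)
Sat t so (eq x y)   ρ σ = proj₁ (ρ x) ≡ proj₁ (ρ y)
Sat t so (mem x X)  ρ σ = σ X (ρ x) ≡ true
Sat t so (neg φ)    ρ σ = ¬ Sat t so φ ρ σ
Sat t so (conj φ ψ) ρ σ = Sat t so φ ρ σ × Sat t so ψ ρ σ
Sat t so (ex₁ φ)    ρ σ = Σ (Pos t) λ p → Sat t so φ (extend p ρ) σ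
Sat t so (ex₂ φ)    ρ σ = Σ (Pos t → Bool) λ X → Sat t so φ ρ (extend X σ)

_,_⊨_ : ∀ {k} (t : Tree k) → SiblingOrder t → Sentence k → Set
t , so ⊨ φ = Sat t so φ (λ ()) (λ ())

SiblingOrderInvariant : ∀ {k} → Sentence k → Set₁
SiblingOrderInvariant {k} φ =
  ∀ (t : Tree k) (so₁ so₂ : SiblingOrder t) →
    (t , so₁ ⊨ φ → t , so₂ ⊨ φ) × (t , so₂ ⊨ φ → t , so₁ ⊨ φ)

DefinedBy : ∀ {k} → Sentence k → Tree k → Set₁
DefinedBy φ t = Σ (SiblingOrder t) λ so → t , so ⊨ φ

record DFA (q : ℕ) : Set where
  field
    nStates : ℕ
    start   : Fin nStates
    accept  : Fin nStates → Bool
    next    : Fin nStates → Fin q → Fin nStates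

_∈L_ : ∀ {q} → List (Fin q) → DFA q → Set
w ∈L A = DFA.accept A (foldl (DFA.next A) (DFA.start A) w) ≡ true

-- Tree automata (Σ, Q, F, δ) with Q = Fin nQ, δ(q,a) regular.

record TreeAutomaton (k : ℕ) : Set where
  field
    nQ    : ℕ
    final : Fin nQ → Bool
    δ     : Fin nQ → Fin k → DFA nQ

ChildrenInOrder : ∀ {k} {t : Tree k} → SiblingOrder t → Pos t → List (Pos t) → Set
ChildrenInOrder so s cs =
  (∀ c → Any (λ d → d ≡ c) cs → IsChild s c) ×
  (∀ y → IsChild s y → Any (λ d → proj₁ d ≡ proj₁ y) cs) ×
  Linked (SiblingOrder._⋖_ so) cs

IsRun : ∀ {k} (N : TreeAutomaton k) (t : Tree k) → SiblingOrder t →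
        (Pos t → Fin (TreeAutomaton.nQ N)) → Set
IsRun N t so ρ = ∀ s cs → ChildrenInOrder so s cs →
  map ρ cs ∈L TreeAutomaton.δ N (ρ s) (label s)

Accepts : ∀ {k} (N : TreeAutomaton k) (t : Tree k) → SiblingOrder t → Set
Accepts N t so = Σ (Pos t → Fin (TreeAutomaton.nQ N)) λ ρ →
  IsRun N t so ρ × (TreeAutomaton.final N (ρ (rootPos t)) ≡ true)

Deterministic : ∀ {k} → TreeAutomaton k → Set
Deterministic {k} N = ∀ (q q' : Fin (TreeAutomaton.nQ N)) (a : Fin k) → q ≢ q' →
  ∀ w → ¬ ((w ∈L TreeAutomaton.δ N q a) × (w ∈L TreeAutomaton.δ N q' a))

⋖-Invariant : ∀ {k} → TreeAutomaton k → Set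
⋖-Invariant {k} N = ∀ (q : Fin (TreeAutomaton.nQ N)) (a : Fin k) w w' →
  w ↭ w' → w ∈L TreeAutomaton.δ N q a → w' ∈L TreeAutomaton.δ N q a

-- Compile φ, by induction on formulas, into a deterministic bottom-up automaton A that reads the
-- children of every node in an order chosen by an arrangement; on the sibling order induced by a
-- well-formed arrangement, A accepts exactly when φ holds. In the canonical arrangement the children
-- are read grouped by their own A-states, so the horizontal computation at a node is a composite,
-- over the state classes in a fixed order, of the transitions for the children of each class.
-- Recording for each class the composite read so far is a horizontal automaton whose letters
-- commute: this gives a deterministic ⋖-invariant automaton N whose unique run labels each node
-- with the A-state of its canonically arranged subtree. Invariance of φ then lets any sibling order
-- stand in for the canonical one.

module Submission where

open import Defs
open import Data.Bool using (Bool; true; false; _∧_; _∨_; not)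
import Data.Bool as Bool
open import Data.Bool.ListAction using (any)
import Data.Bool.Properties as Bool
open import Data.Empty using (⊥; ⊥-elim)
open import Data.Fin using (Fin; toℕ; zero; suc)
import Data.Fin.Properties as Fin
open import Data.List using (List; []; _∷_; [_]; _++_; length; map; foldl; foldr; allFin; cartesianProduct; concatMap; filter)
import Data.List.Membership.DecPropositional as Membership
open import Data.List.Membership.Propositional using (_∈_)
open import Data.List.Membership.Propositional.Properties using (∈-map⁺; ∈-map⁻; ∈-cartesianProduct⁺; ∈-concatMap⁺; ∈-filter⁺; ∈-filter⁻; ∈-allFin)
open import Data.List.Membership.Propositional.Properties.WithK using (unique∧set⇒bag)
open import Data.List.Properties using (∷-injectiveˡ; ∷-injectiveʳ; map-cong; map-cong-local; ≡-dec; foldl-++; foldl-cong; map-concatMap; ++-cancelˡ; ∷ʳ-injective; map-∘)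
open import Data.List.Relation.Binary.BagAndSetEquality using (∼bag⇒↭)
open import Data.List.Relation.Binary.Disjoint.Propositional using (Disjoint)
open import Data.List.Relation.Binary.Permutation.Propositional as ↭ using (_↭_)
import Data.List.Relation.Binary.Permutation.Propositional.Properties as ↭
open import Data.List.Relation.Unary.All as All using (All; []; _∷_)
import Data.List.Relation.Unary.All.Properties as All
open import Data.List.Relation.Unary.AllPairs as AllPairs using (AllPairs; []; _∷_)
import Data.List.Relation.Unary.AllPairs.Properties as AllPairs
open import Data.List.Relation.Unary.Any as Any using (Any; here; there)
open import Data.List.Relation.Unary.Any.Properties using (lookup-index)
open import Data.List.Relation.Unary.Linked.Properties using (AllPairs⇒Linked; Linked⇒AllPairs)
open import Data.List.Relation.Unary.Unique.Propositional using (Unique)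
import Data.List.Relation.Unary.Unique.Propositional.Properties as Unique
open import Data.Nat using (ℕ; zero; suc)
import Data.Nat as ℕ
open import Data.Nat.Properties using (suc-injective)
open import Data.Product using (Σ; ∃; ∃₂; _×_; _,_; proj₁; proj₂)
import Data.Product.Properties as Product
open import Data.Sum using (_⊎_; inj₁; inj₂)
open import Data.Vec using (Vec; tabulate)
import Data.Vec as Vec
import Data.Vec.Properties as Vec
open import Function using (_∘_)
open import Function.Bundles using (_⇔_; mk⇔; Equivalence)
import Function.Properties.Equivalence as ⇔
open import Relation.Binary using (DecidableEquality)
open import Relation.Binary.PropositionalEquality hiding ([_])
open import Relation.Nullary using (Dec; yes; no; ¬_)
open import Relation.Nullary.Decidable using (⌊_⌋)

∧≡true⁻ : ∀ {a b} → a ∧ b ≡ true → a ≡ true × b ≡ true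
∧≡true⁻ {true} {true} _ = refl , refl

∧≡true⁺ : ∀ {a b} → a ≡ true → b ≡ true → a ∧ b ≡ true
∧≡true⁺ refl refl = refl

∨≡true⁻ : ∀ {a b} → a ∨ b ≡ true → a ≡ true ⊎ b ≡ true
∨≡true⁻ {true}  _ = inj₁ refl
∨≡true⁻ {false} e = inj₂ e

∨≡true⁺ˡ : ∀ {a} b → a ≡ true → a ∨ b ≡ true
∨≡true⁺ˡ _ refl = refl

∨≡true⁺ʳ : ∀ a {b} → b ≡ true → a ∨ b ≡ true
∨≡true⁺ʳ true  _ = refl
∨≡true⁺ʳ false e = e

⌊⌋≡true⁻ : ∀ {P : Set} (d : Dec P) → ⌊ d ⌋ ≡ true → P
⌊⌋≡true⁻ (yes p) _ = p

⌊⌋≡true⁺ : ∀ {P : Set} (d : Dec P) → P → ⌊ d ⌋ ≡ true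
⌊⌋≡true⁺ (yes _) _  = refl
⌊⌋≡true⁺ (no ¬p) p = ⊥-elim (¬p p)

any≡true⁻ : ∀ {A : Set} (h : A → Bool) xs → any h xs ≡ true → ∃ λ x → x ∈ xs × h x ≡ true
any≡true⁻ h (x ∷ xs) e with h x in hx
... | true  = x , here refl , hx
... | false = let y , y∈xs , hy = any≡true⁻ h xs e in y , there y∈xs , hy

any≡true⁺ : ∀ {A : Set} (h : A → Bool) {xs x} → x ∈ xs → h x ≡ true → any h xs ≡ true
any≡true⁺ h {y ∷ _} (here refl) hx = ∨≡true⁺ˡ _ hx
any≡true⁺ h {y ∷ _} (there x∈xs) hx = ∨≡true⁺ʳ (h y) (any≡true⁺ h x∈xs hx)

foldl-∨-hom : ∀ {P Q I : Set} {next : P → Q → P} (hflag : P → Bool) (flag : Q → Bool) →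
              (∀ p q → hflag (next p q) ≡ hflag p ∨ flag q) →
              ∀ (h : I → Q) p l → hflag (foldl next p (map h l)) ≡ hflag p ∨ any (flag ∘ h) l
foldl-∨-hom hflag flag hom h p []      = sym (Bool.∨-identityʳ _)
foldl-∨-hom {next = next} hflag flag hom h p (x ∷ l) =
  trans (foldl-∨-hom hflag flag hom h (next p (h x)) l)
        (trans (cong (_∨ any (flag ∘ h) l) (hom p (h x))) (Bool.∨-assoc (hflag p) (flag (h x)) _))

record FinType : Set₁ where
  field
    El       : Set
    _≟_      : DecidableEquality El
    elements : List El
    complete : ∀ x → x ∈ elements

open FinType public

size : FinType → ℕ
size F = length (elements F)

index : (F : FinType) → El F → Fin (size F)
index F x = Any.index (complete F x)

element : (F : FinType) → Fin (size F) → El F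
element F = Data.List.lookup (elements F)

element-index : (F : FinType) (x : El F) → element F (index F x) ≡ x
element-index F x = sym (lookup-index (complete F x))

index-injective : (F : FinType) {x y : El F} → index F x ≡ index F y → x ≡ y
index-injective F {x} {y} e =
  trans (sym (element-index F x)) (trans (cong (element F) e) (element-index F y))

anyᶠ : (F : FinType) → (El F → Bool) → Bool
anyᶠ F h = any h (elements F)

anyᶠ≡true⁻ : (F : FinType) (h : El F → Bool) → anyᶠ F h ≡ true → ∃ λ x → h x ≡ true
anyᶠ≡true⁻ F h e = let x , _ , hx = any≡true⁻ h (elements F) e in x , hx

anyᶠ≡true⁺ : (F : FinType) (h : El F → Bool) (x : El F) → h x ≡ true → anyᶠ F h ≡ true
anyᶠ≡true⁺ F h x = any≡true⁺ h (complete F x)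

vectors : ∀ {A : Set} → List A → (n : ℕ) → List (Vec A n)
vectors xs zero    = [ Vec.[] ]
vectors xs (suc n) = map (λ (x , v) → x Vec.∷ v) (cartesianProduct xs (vectors xs n))

vectors-complete : ∀ {A : Set} {xs : List A} → (∀ x → x ∈ xs) → ∀ {n} (v : Vec A n) → v ∈ vectors xs n
vectors-complete c Vec.[]       = here refl
vectors-complete c (x Vec.∷ v) = ∈-map⁺ _ (∈-cartesianProduct⁺ (c x) (vectors-complete c v))

boolᶠ : FinType
boolᶠ = record
  { El = Bool ; _≟_ = Bool._≟_ ; elements = true ∷ false ∷ []
  ; complete = λ { true → here refl ; false → there (here refl) } }

_×ᶠ_ : FinType → FinType → FinType
F ×ᶠ G = record
  { El = El F × El G ; _≟_ = Product.≡-dec (_≟_ F) (_≟_ G)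
  ; elements = cartesianProduct (elements F) (elements G)
  ; complete = λ (x , y) → ∈-cartesianProduct⁺ (complete F x) (complete G y) }

vecᶠ : ℕ → FinType → FinType
vecᶠ n F = record
  { El = Vec (El F) n ; _≟_ = Vec.≡-dec (_≟_ F)
  ; elements = vectors (elements F) n ; complete = vectors-complete (complete F) }

-- A function F → G is stored as the vector of its values, indexed by `index F`.
_⇒ᶠ_ : FinType → FinType → FinType
F ⇒ᶠ G = vecᶠ (size F) G

apply : (F G : FinType) → El (F ⇒ᶠ G) → El F → El G
apply F G h x = Vec.lookup h (index F x)

abstractᶠ : (F G : FinType) → (El F → El G) → El (F ⇒ᶠ G)
abstractᶠ F G g = tabulate (g ∘ element F)

apply-abstract : (F G : FinType) (g : El F → El G) (x : El F) → apply F G (abstractᶠ F G g) x ≡ g x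
apply-abstract F G g x = trans (Vec.lookup∘tabulate _ (index F x)) (cong g (element-index F x))

℘ : FinType → FinType
℘ F = F ⇒ᶠ boolᶠ

module _ {k : ℕ} where

  root∈ : (t : Tree k) → [] ∈D t
  root∈ (node _ _) = root

  inChild : ∀ {a} {ts : List (Tree k)} (i : Fin (length ts)) → Pos (Data.List.lookup ts i) → Pos (node a ts)
  inChild i (w , p) = suc (toℕ i) ∷ w , step i p

  -- stated up to a path equation, since `toℕ` is not injective definitionally
  ∈D-irrelevant : ∀ {t : Tree k} {w w'} (p : w ∈D t) (q : w' ∈D t) (e : w ≡ w') → subst (_∈D t) e p ≡ q
  ∈D-irrelevant root       root       refl = refl
  ∈D-irrelevant (step i p) (step j q) e with Fin.toℕ-injective (suc-injective (∷-injectiveˡ e))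
  ... | refl with refl ← e = cong (step i) (∈D-irrelevant p q refl)

  Pos-≡ : ∀ {t : Tree k} (x y : Pos t) → proj₁ x ≡ proj₁ y → x ≡ y
  Pos-≡ (w , p) (.w , q) refl = cong (w ,_) (∈D-irrelevant p q refl)

  root-unique : ∀ {t : Tree k} (p : [] ∈D t) → ([] , p) ≡ rootPos t
  root-unique root = refl

  -- An order of the children at every node, as a list of their indices.
  data Arrangement : Tree k → Set where
    arrange : ∀ {a ts} (perm : List (Fin (length ts))) →
              ((i : Fin (length ts)) → Arrangement (Data.List.lookup ts i)) → Arrangement (node a ts)

  WellFormed : ∀ {t} → Arrangement t → Set
  WellFormed (arrange perm Os) = Unique perm × (∀ i → i ∈ perm) × (∀ i → WellFormed (Os i))

data Precedes {A : Set} : List A → A → A → Set where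
  first : ∀ {i j l} → j ∈ l → Precedes (i ∷ l) i j
  later : ∀ {x i j l} → Precedes l i j → Precedes (x ∷ l) i j

precedes? : ∀ {n} (l : List (Fin n)) i j → Dec (Precedes l i j)
precedes? []      i j = no λ ()
precedes? (x ∷ l) i j with x Fin.≟ i | precedes? l i j
... | _        | yes p = yes (later p)
... | no x≢i   | no ¬p = no λ { (first _) → x≢i refl ; (later p) → ¬p p }
... | yes refl | no ¬p with Membership._∈?_ Fin._≟_ j l
...   | yes j∈l = yes (first j∈l)
...   | no j∉l  = no λ { (first j∈l) → j∉l j∈l ; (later p) → ¬p p }

module _ {A : Set} where

  precedes-∈ʳ : ∀ {l : List A} {i j} → Precedes l i j → j ∈ l
  precedes-∈ʳ (first j∈l) = there j∈l
  precedes-∈ʳ (later p)   = there (precedes-∈ʳ p)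

  head∉tail : ∀ {x : A} {l} → Unique (x ∷ l) → x ∈ l → ⊥
  head∉tail (x∉l ∷ _) = All.All¬⇒¬Any x∉l

  precedes-irrefl : ∀ {l : List A} {i} → Unique l → ¬ Precedes l i i
  precedes-irrefl u          (first i∈l) = head∉tail u i∈l
  precedes-irrefl (_ ∷ u)    (later p)   = precedes-irrefl u p

  precedes-trans : ∀ {l : List A} {i j m} → Unique l → Precedes l i j → Precedes l j m → Precedes l i m
  precedes-trans u       (first _) (first m∈l) = first m∈l
  precedes-trans u       (first _) (later q)   = first (precedes-∈ʳ q)
  precedes-trans u       (later p) (first _)   = ⊥-elim (head∉tail u (precedes-∈ʳ p))
  precedes-trans (_ ∷ u) (later p) (later q)   = later (precedes-trans u p q)

  precedes-total : ∀ {l : List A} {i j} → i ∈ l → j ∈ l → i ≢ j → Precedes l i j ⊎ Precedes l j i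
  precedes-total (here refl) (here refl) i≢j = ⊥-elim (i≢j refl)
  precedes-total (here refl) (there j∈l) _   = inj₁ (first j∈l)
  precedes-total (there i∈l) (here refl) _   = inj₂ (first i∈l)
  precedes-total (there i∈l) (there j∈l) i≢j with precedes-total i∈l j∈l i≢j
  ... | inj₁ p = inj₁ (later p)
  ... | inj₂ p = inj₂ (later p)

module _ {k : ℕ} where

  data Earlier : ∀ {t : Tree k} → Arrangement t → ∀ {w w'} → w ∈D t → w' ∈D t → Set where
    at-root : ∀ {a ts perm Os} {i j : Fin (length ts)} {p : [] ∈D Data.List.lookup ts i} {q : [] ∈D Data.List.lookup ts j} →
              Precedes perm i j → Earlier (arrange {a = a} {ts = ts} perm Os) (step i p) (step j q)
    inside  : ∀ {a ts perm Os} {i : Fin (length ts)} {w w'} {p : w ∈D Data.List.lookup ts i} {q : w' ∈D Data.List.lookup ts i} →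
              Earlier (Os i) p q → Earlier (arrange {a = a} {ts = ts} perm Os) (step i p) (step i q)

  earlier-nonrootˡ : ∀ {t} {O : Arrangement t} {w w'} {p : w ∈D t} {q : w' ∈D t} → Earlier O p q → w ≢ []
  earlier-nonrootˡ (at-root _) ()
  earlier-nonrootˡ (inside _)  ()

  earlier-nonrootʳ : ∀ {t} {O : Arrangement t} {w w'} {p : w ∈D t} {q : w' ∈D t} → Earlier O p q → w' ≢ []
  earlier-nonrootʳ (at-root _) ()
  earlier-nonrootʳ (inside _)  ()

  earlier? : ∀ {t} (O : Arrangement t) {w w'} (p : w ∈D t) (q : w' ∈D t) → Dec (Earlier O p q)
  earlier? (arrange perm Os) root       q    = no λ ()
  earlier? (arrange perm Os) (step i p) root = no λ ()
  earlier? (arrange perm Os) (step {w = []} i p) (step {w = []} j q) with precedes? perm i j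
  ... | yes i<j = yes (at-root i<j)
  ... | no ¬i<j = no λ { (at-root i<j) → ¬i<j i<j ; (inside e) → earlier-nonrootˡ e refl }
  earlier? (arrange perm Os) (step {w = []} i p) (step {w = _ ∷ _} j q) = no λ { (inside e) → earlier-nonrootˡ e refl }
  earlier? (arrange perm Os) (step {w = _ ∷ _} i p) (step j q) with i Fin.≟ j
  ... | no i≢j   = no λ { (inside _) → i≢j refl }
  ... | yes refl with earlier? (Os i) p q
  ...   | yes e = yes (inside e)
  ...   | no ¬e = no λ { (inside e) → ¬e e }

  earlier-siblings : ∀ {t} {O : Arrangement t} → WellFormed O → ∀ {w w'} {p : w ∈D t} {q : w' ∈D t} → Earlier O p q →
                     Σ (List ℕ) λ s → ∃₂ λ (i j : ℕ) → (w ≡ s ++ [ i ]) × (w' ≡ s ++ [ j ]) × (i ≢ j)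
  earlier-siblings (u , _ , _) (at-root {i = i} {j = j} i<j) =
    [] , suc (toℕ i) , suc (toℕ j) , refl , refl ,
    λ e → precedes-irrefl u (subst (Precedes _ i) (sym (Fin.toℕ-injective (suc-injective e))) i<j)
  earlier-siblings (_ , _ , wf) (inside {i = i} e) =
    let s , a , b , e₁ , e₂ , a≢b = earlier-siblings (wf i) e
    in suc (toℕ i) ∷ s , a , b , cong (suc (toℕ i) ∷_) e₁ , cong (suc (toℕ i) ∷_) e₂ , a≢b

  earlier-trans : ∀ {t} {O : Arrangement t} → WellFormed O → ∀ {w w' w''} {p : w ∈D t} {q : w' ∈D t} {r : w'' ∈D t} →
                  Earlier O p q → Earlier O q r → Earlier O p r
  earlier-trans (u , _ , _)  (at-root i<j) (at-root j<m) = at-root (precedes-trans u i<j j<m)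
  earlier-trans _            (at-root _)   (inside e)    = ⊥-elim (earlier-nonrootˡ e refl)
  earlier-trans _            (inside e)    (at-root _)   = ⊥-elim (earlier-nonrootʳ e refl)
  earlier-trans (_ , _ , wf) (inside {i = i} e) (inside e') = inside (earlier-trans (wf i) e e')

  []≢∷ʳ : ∀ {A : Set} (xs : List A) {c} → [] ≢ xs ++ [ c ]
  []≢∷ʳ []      ()
  []≢∷ʳ (_ ∷ _) ()

  earlier-total : ∀ {t} (O : Arrangement t) → WellFormed O → ∀ {ws wx wy cx cy} (ps : ws ∈D t) (px : wx ∈D t) (py : wy ∈D t) →
                  wx ≡ ws ++ [ cx ] → wy ≡ ws ++ [ cy ] → wx ≢ wy → Earlier O px py ⊎ Earlier O py px
  earlier-total (arrange perm Os) _ ps root py ex ey _ = ⊥-elim ([]≢∷ʳ _ ex)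
  earlier-total (arrange perm Os) _ ps (step i px) root ex ey _ = ⊥-elim ([]≢∷ʳ _ ey)
  earlier-total (arrange perm Os) (_ , all∈ , _) root (step {w = []} i px) (step {w = []} j py) _ _ x≢y
    with precedes-total (all∈ i) (all∈ j) (λ e → x≢y (cong (λ z → suc (toℕ z) ∷ []) e))
  ... | inj₁ i<j = inj₁ (at-root i<j)
  ... | inj₂ j<i = inj₂ (at-root j<i)
  earlier-total (arrange perm Os) _ root (step {w = _ ∷ _} i px) (step j py) () _ _
  earlier-total (arrange perm Os) _ root (step {w = []} i px) (step {w = _ ∷ _} j py) _ () _
  earlier-total (arrange perm Os) (_ , _ , wf) (step i ps) (step i₁ px) (step i₂ py) ex ey x≢y
    with Fin.toℕ-injective (suc-injective (∷-injectiveˡ ex)) | Fin.toℕ-injective (suc-injective (∷-injectiveˡ ey))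
  ... | refl | refl with earlier-total (Os i) (wf i) ps px py (∷-injectiveʳ ex) (∷-injectiveʳ ey) (x≢y ∘ cong (suc (toℕ i) ∷_))
  ...   | inj₁ e = inj₁ (inside e)
  ...   | inj₂ e = inj₂ (inside e)

  arrangementOrder : ∀ {t} (O : Arrangement t) → WellFormed O → SiblingOrder t
  arrangementOrder O wf = record
    { _⋖_      = λ x y → Earlier O (proj₂ x) (proj₂ y)
    ; ⋖-dec    = λ x y → earlier? O (proj₂ x) (proj₂ y)
    ; siblings = λ _ _ → earlier-siblings wf
    ; trans    = λ _ _ _ → earlier-trans wf
    ; total    = λ s x y (_ , ex) (_ , ey) → earlier-total O wf (proj₂ s) (proj₂ x) (proj₂ y) ex ey
    }

record DTA (B : Set) : Set₁ where
  field
    Q P  : FinType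
    init : El P
    next : El P → El Q → El P
    out  : B → El P → El Q

module _ {k : ℕ} {B : Set} (A : DTA B) where
  open DTA A

  evaluate : ∀ {t : Tree k} → Arrangement t → (Pos t → B) → El Q
  evaluate (arrange perm Os) f =
    out (f ([] , root)) (foldl next init (map (λ i → evaluate (Os i) (f ∘ inChild i)) perm))

  evaluate-cong : ∀ {t : Tree k} (O : Arrangement t) {f g : Pos t → B} → (∀ x → f x ≡ g x) → evaluate O f ≡ evaluate O g
  evaluate-cong (arrange perm Os) f≗g =
    cong₂ out (f≗g _) (cong (foldl next init) (map-cong (λ i → evaluate-cong (Os i) (f≗g ∘ inChild i)) perm))

_⊗_ : ∀ {B} → DTA B → DTA B → DTA B
A ⊗ A' = record
  { Q = DTA.Q A ×ᶠ DTA.Q A' ; P = DTA.P A ×ᶠ DTA.P A'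
  ; init = DTA.init A , DTA.init A'
  ; next = λ (p , p') (q , q') → DTA.next A p q , DTA.next A' p' q'
  ; out = λ b (p , p') → DTA.out A b p , DTA.out A' b p' }

module _ {k : ℕ} {B : Set} (A A' : DTA B) where

  evaluate-⊗ : ∀ {t : Tree k} (O : Arrangement t) (f : Pos t → B) →
               evaluate (A ⊗ A') O f ≡ (evaluate A O f , evaluate A' O f)
  evaluate-⊗ (arrange {ts = ts} perm Os) f =
    cong (λ (p , p') → DTA.out A (f _) p , DTA.out A' (f _) p') (fold perm _ _)
    where
    fold : ∀ l p p' → foldl (DTA.next (A ⊗ A')) (p , p') (map (λ i → evaluate (A ⊗ A') (Os i) (f ∘ inChild i)) l)
                    ≡ (foldl (DTA.next A) p (map (λ i → evaluate A (Os i) (f ∘ inChild i)) l) ,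
                       foldl (DTA.next A') p' (map (λ i → evaluate A' (Os i) (f ∘ inChild i)) l))
    fold []      p p' = refl
    fold (i ∷ l) p p' rewrite evaluate-⊗ (Os i) (f ∘ inChild i) = fold l _ _

record Detects {B : Set} (A : DTA B) (e : B → Bool) : Set where
  field
    flag       : El (DTA.Q A) → Bool
    hflag      : El (DTA.P A) → Bool
    flag-out   : ∀ b p → flag (DTA.out A b p) ≡ e b ∨ hflag p
    hflag-next : ∀ p q → hflag (DTA.next A p q) ≡ hflag p ∨ flag q
    hflag-init : hflag (DTA.init A) ≡ false

hflag-foldl : ∀ {B : Set} {A : DTA B} {e : B → Bool} (D : Detects A e) {I : Set} (h : I → El (DTA.Q A)) p l →
              Detects.hflag D (foldl (DTA.next A) p (map h l)) ≡ Detects.hflag D p ∨ any (Detects.flag D ∘ h) l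
hflag-foldl D = foldl-∨-hom (Detects.hflag D) (Detects.flag D) (Detects.hflag-next D)

module _ {k : ℕ} {B : Set} {A : DTA B} {e : B → Bool} (D : Detects A e) where
  open Detects D
  open DTA A using (init)

  detects-sound : ∀ {t : Tree k} (O : Arrangement t) f → flag (evaluate A O f) ≡ true → ∃ λ (x : Pos t) → e (f x) ≡ true
  detects-sound (arrange perm Os) f h with ∨≡true⁻ (trans (sym (flag-out _ _)) h)
  ... | inj₁ at-top = _ , at-top
  ... | inj₂ below with ∨≡true⁻ (trans (sym (hflag-foldl D _ init perm)) below)
  ...   | inj₁ initial with () ← trans (sym hflag-init) initial
  ...   | inj₂ in-child =
    let i , _ , hi = any≡true⁻ _ perm in-child
        x , ex = detects-sound (Os i) (f ∘ inChild i) hi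
    in inChild i x , ex

  detects-complete : ∀ {t : Tree k} (O : Arrangement t) → WellFormed O → ∀ f (x : Pos t) → e (f x) ≡ true →
                     flag (evaluate A O f) ≡ true
  detects-complete (arrange perm Os) _ f ([] , root) ex = trans (flag-out _ _) (∨≡true⁺ˡ _ ex)
  detects-complete (arrange perm Os) (_ , all∈ , wf) f (_ , step i p) ex =
    trans (flag-out _ _) (∨≡true⁺ʳ _ (trans (hflag-foldl D _ init perm)
      (∨≡true⁺ʳ _ (any≡true⁺ _ (all∈ i) (detects-complete (Os i) (wf i) (f ∘ inChild i) (_ , p) ex)))))

existsA : ∀ {B : Set} → (B → Bool) → DTA B
existsA e = record { Q = boolᶠ ; P = boolᶠ ; init = false ; next = _∨_ ; out = λ b p → e b ∨ p }

existsA-detects : ∀ {B : Set} (e : B → Bool) → Detects (existsA e) e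
existsA-detects e = record
  { flag = λ q → q ; hflag = λ p → p ; flag-out = λ _ _ → refl ; hflag-next = λ _ _ → refl ; hflag-init = refl }

-- Scanning a list with state (seen an X, found), where "found" means: some element satisfies G, or an X-element precedes a Y-element.
module PairScan {V : Set} (X Y G : V → Bool) where

  scan : Bool × Bool → V → Bool × Bool
  scan sg v = proj₁ sg ∨ X v , (proj₂ sg ∨ G v) ∨ (proj₁ sg ∧ Y v)

  data Found {I : Set} (h : I → V) (sg : Bool × Bool) (l : List I) : Set where
    found-initially : proj₂ sg ≡ true → Found h sg l
    found-G         : ∀ i → i ∈ l → G (h i) ≡ true → Found h sg l
    found-Y         : proj₁ sg ≡ true → ∀ j → j ∈ l → Y (h j) ≡ true → Found h sg l
    found-XY        : ∀ i j → Precedes l i j → X (h i) ≡ true → Y (h j) ≡ true → Found h sg l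

  module _ {I : Set} (h : I → V) where

    scan-found : ∀ sg l → proj₂ (foldl scan sg (map h l)) ≡ true → Found h sg l
    scan-found sg []      e = found-initially e
    scan-found sg (x ∷ l) e with scan-found (scan sg (h x)) l e
    ... | found-initially e′ with ∨≡true⁻ e′
    ...   | inj₂ e″ = let s , y = ∧≡true⁻ e″ in found-Y s x (here refl) y
    ...   | inj₁ e″ with ∨≡true⁻ e″
    ...     | inj₁ f = found-initially f
    ...     | inj₂ g = found-G x (here refl) g
    scan-found sg (x ∷ l) e | found-G i i∈l g = found-G i (there i∈l) g
    scan-found sg (x ∷ l) e | found-Y s j j∈l y with ∨≡true⁻ s
    ... | inj₁ s′ = found-Y s′ j (there j∈l) y
    ... | inj₂ xx = found-XY x j (first j∈l) xx y
    scan-found sg (x ∷ l) e | found-XY i j i<j xi yj = found-XY i j (later i<j) xi yj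

    scan-keeps : ∀ sg l → proj₂ sg ≡ true → proj₂ (foldl scan sg (map h l)) ≡ true
    scan-keeps sg []      f = f
    scan-keeps sg (x ∷ l) f = scan-keeps _ l (∨≡true⁺ˡ _ (∨≡true⁺ˡ _ f))

    scan-G : ∀ sg {l i} → i ∈ l → G (h i) ≡ true → proj₂ (foldl scan sg (map h l)) ≡ true
    scan-G sg {x ∷ l} (here refl) g = scan-keeps _ l (∨≡true⁺ˡ _ (∨≡true⁺ʳ (proj₂ sg) g))
    scan-G sg {x ∷ l} (there i∈l) g = scan-G _ i∈l g

    scan-Y : ∀ sg {l j} → proj₁ sg ≡ true → j ∈ l → Y (h j) ≡ true → proj₂ (foldl scan sg (map h l)) ≡ true
    scan-Y sg {x ∷ l} s (here refl) y = scan-keeps _ l (∨≡true⁺ʳ _ (∧≡true⁺ s y))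
    scan-Y sg {x ∷ l} s (there j∈l) y = scan-Y _ (∨≡true⁺ˡ _ s) j∈l y

    scan-XY : ∀ sg {l i j} → Precedes l i j → X (h i) ≡ true → Y (h j) ≡ true → proj₂ (foldl scan sg (map h l)) ≡ true
    scan-XY sg {x ∷ l} (first j∈l) xi yj = scan-Y _ (∨≡true⁺ʳ _ xi) j∈l yj
    scan-XY sg {x ∷ l} (later i<j) xi yj = scan-XY _ i<j xi yj

descendantA : ∀ {B : Set} → (B → Bool) → (B → Bool) → DTA B
descendantA bx by = record
  { Q = boolᶠ ×ᶠ boolᶠ ; P = boolᶠ ×ᶠ boolᶠ ; init = false , false
  ; next = λ p q → proj₁ p ∨ proj₁ q , proj₂ p ∨ proj₂ q
  ; out  = λ b p → by b ∨ proj₁ p , proj₂ p ∨ (bx b ∧ proj₁ p) }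

module _ {k : ℕ} {B : Set} (bx by : B → Bool) where
  private
    D = descendantA bx by

    detects-Y : Detects D by
    detects-Y = record
      { flag = proj₁ ; hflag = proj₁ ; flag-out = λ _ _ → refl ; hflag-next = λ _ _ → refl ; hflag-init = refl }

    pair-foldl : ∀ {I : Set} (h : I → Bool × Bool) p l →
                 proj₂ (foldl (DTA.next D) p (map h l)) ≡ proj₂ p ∨ any (proj₂ ∘ h) l
    pair-foldl = foldl-∨-hom proj₂ proj₂ (λ _ _ → refl)

  descendantA-sound : ∀ {t : Tree k} (O : Arrangement t) f → proj₂ (evaluate D O f) ≡ true →
                      ∃₂ λ (x y : Pos t) → x ≺ y × bx (f x) ≡ true × by (f y) ≡ true
  descendantA-sound (arrange perm Os) f e with ∨≡true⁻ e
  ... | inj₁ in-child =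
    let i , _ , ei = any≡true⁻ _ perm (trans (sym (pair-foldl _ (false , false) perm)) in-child)
        x , y , (c , r , y≡) , xx , yy = descendantA-sound (Os i) (f ∘ inChild i) ei
    in inChild i x , inChild i y , (c , r , cong (suc (toℕ i) ∷_) y≡) , xx , yy
  ... | inj₂ at-top =
    let xr , below = ∧≡true⁻ at-top
        i , _ , ei = any≡true⁻ _ perm (trans (sym (hflag-foldl detects-Y _ (false , false) perm)) below)
        y , yy = detects-sound detects-Y (Os i) (f ∘ inChild i) ei
    in ([] , root) , inChild i y , (suc (toℕ i) , proj₁ y , refl) , xr , yy

  descendantA-complete : ∀ {t : Tree k} (O : Arrangement t) → WellFormed O → ∀ f (x y : Pos t) → x ≺ y →
                         bx (f x) ≡ true → by (f y) ≡ true → proj₂ (evaluate D O f) ≡ true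
  descendantA-complete (arrange perm Os) _ f (_ , root) (_ , root) (_ , _ , ()) _ _
  descendantA-complete (arrange perm Os) (_ , all∈ , wf) f (_ , root) (_ , step j q) _ xx yy =
    ∨≡true⁺ʳ _ (∧≡true⁺ xx (trans (hflag-foldl detects-Y _ (false , false) perm)
      (any≡true⁺ _ (all∈ j) (detects-complete detects-Y (Os j) (wf j) (f ∘ inChild j) (_ , q) yy))))
  descendantA-complete (arrange perm Os) _ f (_ , step i p) (_ , root) (_ , _ , ()) _ _
  descendantA-complete (arrange perm Os) (_ , all∈ , wf) f (_ , step i p) (_ , step j q) (c , r , y≡) xx yy
    with Fin.toℕ-injective (suc-injective (∷-injectiveˡ y≡))
  ... | refl = ∨≡true⁺ˡ _ (trans (pair-foldl _ (false , false) perm)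
      (any≡true⁺ _ (all∈ i) (descendantA-complete (Os i) (wf i) (f ∘ inChild i) (_ , p) (_ , q) (c , r , ∷-injectiveʳ y≡) xx yy)))

-- A node's state records whether it is an X-node, whether it is a Y-node, and whether an X-sibling precedes a Y-sibling in its subtree.
siblingA : ∀ {B : Set} → (B → Bool) → (B → Bool) → DTA B
siblingA bx by = record
  { Q = boolᶠ ×ᶠ (boolᶠ ×ᶠ boolᶠ) ; P = boolᶠ ×ᶠ boolᶠ ; init = false , false
  ; next = PairScan.scan proj₁ (proj₁ ∘ proj₂) (proj₂ ∘ proj₂)
  ; out  = λ b p → bx b , by b , proj₂ p }

module _ {k : ℕ} {B : Set} (bx by : B → Bool) where
  private
    S = siblingA bx by
  open PairScan {El (DTA.Q S)} proj₁ (proj₁ ∘ proj₂) (proj₂ ∘ proj₂)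

  private
    isX : ∀ {t : Tree k} (O : Arrangement t) f → proj₁ (evaluate S O f) ≡ bx (f (rootPos t))
    isX (arrange _ _) f = refl

    isY : ∀ {t : Tree k} (O : Arrangement t) f → proj₁ (proj₂ (evaluate S O f)) ≡ by (f (rootPos t))
    isY (arrange _ _) f = refl

  siblingA-sound : ∀ {t : Tree k} (O : Arrangement t) f → proj₂ (proj₂ (evaluate S O f)) ≡ true →
                   ∃₂ λ (x y : Pos t) → Earlier O (proj₂ x) (proj₂ y) × bx (f x) ≡ true × by (f y) ≡ true
  siblingA-sound (arrange {ts = ts} perm Os) f e with scan-found (λ i → evaluate S (Os i) (f ∘ inChild i)) (false , false) perm e
  ... | found-G i _ ei =
    let x , y , x<y , xx , yy = siblingA-sound (Os i) (f ∘ inChild i) ei in inChild i x , inChild i y , inside x<y , xx , yy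
  ... | found-XY i j i<j xi yj =
    inChild i ([] , root∈ _) , inChild j ([] , root∈ _) , at-root i<j ,
    trans (cong (bx ∘ f ∘ inChild i) (root-unique _)) (trans (sym (isX (Os i) (f ∘ inChild i))) xi) ,
    trans (cong (by ∘ f ∘ inChild j) (root-unique _)) (trans (sym (isY (Os j) (f ∘ inChild j))) yj)

  siblingA-complete : ∀ {t : Tree k} (O : Arrangement t) → WellFormed O → ∀ f {w w'} (p : w ∈D t) (q : w' ∈D t) →
                      Earlier O p q → bx (f (w , p)) ≡ true → by (f (w' , q)) ≡ true → proj₂ (proj₂ (evaluate S O f)) ≡ true
  siblingA-complete (arrange perm Os) _ f (step i p) (step j q) (at-root i<j) xx yy =
    scan-XY (λ i → evaluate S (Os i) (f ∘ inChild i)) (false , false) i<j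
      (trans (isX (Os i) (f ∘ inChild i)) (trans (cong (bx ∘ f ∘ inChild i) (sym (root-unique p))) xx))
      (trans (isY (Os j) (f ∘ inChild j)) (trans (cong (by ∘ f ∘ inChild j) (sym (root-unique q))) yy))
  siblingA-complete (arrange perm Os) (_ , all∈ , wf) f (step i p) (step .i q) (inside p<q) xx yy =
    scan-G (λ i → evaluate S (Os i) (f ∘ inChild i)) (false , false) (all∈ i)
      (siblingA-complete (Os i) (wf i) (f ∘ inChild i) p q p<q xx yy)

-- A node's state records whether its subtree has a node satisfying s, and whether it has two.
singletonA : ∀ {B : Set} → (B → Bool) → DTA B
singletonA s = record
  { Q = boolᶠ ×ᶠ boolᶠ ; P = boolᶠ ×ᶠ boolᶠ ; init = false , false
  ; next = PairScan.scan proj₁ proj₁ proj₂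
  ; out  = λ b p → s b ∨ proj₁ p , proj₂ p ∨ (s b ∧ proj₁ p) }

exactlyOne : Bool × Bool → Bool
exactlyOne q = proj₁ q ∧ not (proj₂ q)

_≟ʷ_ : DecidableEquality (List ℕ)
_≟ʷ_ = ≡-dec ℕ._≟_

module _ {k : ℕ} {B : Set} (s : B → Bool) where
  private
    S = singletonA s

    detects-s : Detects S s
    detects-s = record
      { flag = proj₁ ; hflag = proj₁ ; flag-out = λ _ _ → refl ; hflag-next = λ _ _ → refl ; hflag-init = refl }

  open PairScan {El (DTA.Q S)} proj₁ proj₁ proj₂

  twoA-sound : ∀ {t : Tree k} (O : Arrangement t) → WellFormed O → ∀ f → proj₂ (evaluate S O f) ≡ true →
               ∃₂ λ (x y : Pos t) → s (f x) ≡ true × s (f y) ≡ true × proj₁ x ≢ proj₁ y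
  twoA-sound (arrange perm Os) (u , _ , wf) f e with ∨≡true⁻ e
  ... | inj₂ at-top =
    let sr , below = ∧≡true⁻ at-top
        i , _ , ei = any≡true⁻ _ perm (trans (sym (hflag-foldl detects-s _ (false , false) perm)) below)
        y , sy = detects-sound detects-s (Os i) (f ∘ inChild i) ei
    in ([] , root) , inChild i y , sr , sy , λ ()
  ... | inj₁ in-children with scan-found (λ i → evaluate S (Os i) (f ∘ inChild i)) (false , false) perm in-children
  ...   | found-G i _ ei =
    let x , y , sx , sy , x≢y = twoA-sound (Os i) (wf i) (f ∘ inChild i) ei
    in inChild i x , inChild i y , sx , sy , x≢y ∘ ∷-injectiveʳ
  ...   | found-XY i j i<j ei ej =
    let x , sx = detects-sound detects-s (Os i) (f ∘ inChild i) ei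
        y , sy = detects-sound detects-s (Os j) (f ∘ inChild j) ej
    in inChild i x , inChild j y , sx , sy ,
       λ e′ → precedes-irrefl u (subst (Precedes perm i) (sym (Fin.toℕ-injective (suc-injective (∷-injectiveˡ e′)))) i<j)

  twoA-complete : ∀ {t : Tree k} (O : Arrangement t) → WellFormed O → ∀ f (x y : Pos t) →
                  s (f x) ≡ true → s (f y) ≡ true → proj₁ x ≢ proj₁ y → proj₂ (evaluate S O f) ≡ true
  twoA-complete (arrange perm Os) _ f (_ , root) (_ , root) _ _ x≢y = ⊥-elim (x≢y refl)
  twoA-complete (arrange perm Os) (_ , all∈ , wf) f (_ , root) (_ , step j q) sx sy _ =
    ∨≡true⁺ʳ _ (∧≡true⁺ sx (trans (hflag-foldl detects-s _ (false , false) perm)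
      (any≡true⁺ _ (all∈ j) (detects-complete detects-s (Os j) (wf j) (f ∘ inChild j) (_ , q) sy))))
  twoA-complete (arrange perm Os) (_ , all∈ , wf) f (_ , step i p) (_ , root) sx sy _ =
    ∨≡true⁺ʳ _ (∧≡true⁺ sy (trans (hflag-foldl detects-s _ (false , false) perm)
      (any≡true⁺ _ (all∈ i) (detects-complete detects-s (Os i) (wf i) (f ∘ inChild i) (_ , p) sx))))
  twoA-complete (arrange perm Os) (_ , all∈ , wf) f (_ , step i p) (_ , step j q) sx sy x≢y with i Fin.≟ j
  ... | yes refl = ∨≡true⁺ˡ _ (scan-G (λ i → evaluate S (Os i) (f ∘ inChild i)) (false , false) (all∈ i)
        (twoA-complete (Os i) (wf i) (f ∘ inChild i) (_ , p) (_ , q) sx sy (x≢y ∘ cong (suc (toℕ i) ∷_))))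
  ... | no i≢j with precedes-total (all∈ i) (all∈ j) i≢j
  ...   | inj₁ i<j = ∨≡true⁺ˡ _ (scan-XY (λ i → evaluate S (Os i) (f ∘ inChild i)) (false , false) i<j
          (detects-complete detects-s (Os i) (wf i) (f ∘ inChild i) (_ , p) sx)
          (detects-complete detects-s (Os j) (wf j) (f ∘ inChild j) (_ , q) sy))
  ...   | inj₂ j<i = ∨≡true⁺ˡ _ (scan-XY (λ i → evaluate S (Os i) (f ∘ inChild i)) (false , false) j<i
          (detects-complete detects-s (Os j) (wf j) (f ∘ inChild j) (_ , q) sy)
          (detects-complete detects-s (Os i) (wf i) (f ∘ inChild i) (_ , p) sx))

  singletonA-sound : ∀ {t : Tree k} (O : Arrangement t) → WellFormed O → ∀ f → exactlyOne (evaluate S O f) ≡ true →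
                     ∃ λ (p : Pos t) → s (f p) ≡ true × (∀ q → s (f q) ≡ true → proj₁ q ≡ proj₁ p)
  singletonA-sound O wf f e =
    let one , not-two = ∧≡true⁻ e
        p , sp = detects-sound detects-s O f one
    in p , sp , unique p sp (trans (sym (Bool.not-involutive _)) (cong not not-two))
    where
    unique : ∀ p → s (f p) ≡ true → proj₂ (evaluate S O f) ≡ false → ∀ q → s (f q) ≡ true → proj₁ q ≡ proj₁ p
    unique p sp no-two q sq with proj₁ q ≟ʷ proj₁ p
    ... | yes q≡p = q≡p
    ... | no q≢p with () ← trans (sym no-two) (twoA-complete O wf f q p sq sp q≢p)

  singletonA-complete : ∀ {t : Tree k} (O : Arrangement t) → WellFormed O → ∀ f (p : Pos t) → s (f p) ≡ true →
                        (∀ q → s (f q) ≡ true → proj₁ q ≡ proj₁ p) → exactlyOne (evaluate S O f) ≡ true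
  singletonA-complete O wf f p sp unique with proj₂ (evaluate S O f) in two
  ... | false = ∧≡true⁺ (detects-complete detects-s O wf f p sp) refl
  ... | true  = let x , y , sx , sy , x≢y = twoA-sound O wf f two in ⊥-elim (x≢y (trans (unique x sx) (sym (unique y sy))))

-- The subset construction

override : ∀ {n} {X : Fin n → Set} → ((j : Fin n) → X j → Bool) → (i : Fin n) → (X i → Bool) → (j : Fin n) → X j → Bool
override G i g j with i Fin.≟ j
... | yes refl = g
... | no _     = G j

override-same : ∀ {n} {X : Fin n → Set} (G : (j : Fin n) → X j → Bool) i g x → override {X = X} G i g i x ≡ g x
override-same G i g x with i Fin.≟ i
... | yes refl = refl
... | no i≢i   = ⊥-elim (i≢i refl)

override-other : ∀ {n} {X : Fin n → Set} (G : (j : Fin n) → X j → Bool) i g j → i ≢ j → ∀ x → override {X = X} G i g j x ≡ G j x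
override-other G i g j i≢j x with i Fin.≟ j
... | yes i≡j = ⊥-elim (i≢j i≡j)
... | no _    = refl

-- projectA guesses, at every node, the extra bit that `annotate` adds to the label.
module Projection {B B' : Set} (A : DTA B') (annotate : B → Bool → B') where
  open DTA A

  memQ : El (℘ Q) → El Q → Bool
  memQ = apply Q boolᶠ

  memP : El (℘ P) → El P → Bool
  memP = apply P boolᶠ

  initSet : El P → Bool
  initSet p = ⌊ _≟_ P p init ⌋

  nextSet : El (℘ P) → El (℘ Q) → El P → Bool
  nextSet S T r = anyᶠ P λ p → memP S p ∧ anyᶠ Q λ q → memQ T q ∧ ⌊ _≟_ P (next p q) r ⌋

  outSet : B → El (℘ P) → El Q → Bool
  outSet b S r = anyᶠ P λ p → memP S p ∧ anyᶠ boolᶠ λ bit → ⌊ _≟_ Q (out (annotate b bit) p) r ⌋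

  projectA : DTA B
  projectA = record
    { Q = ℘ Q ; P = ℘ P
    ; init = abstractᶠ P boolᶠ initSet
    ; next = λ S T → abstractᶠ P boolᶠ (nextSet S T)
    ; out  = λ b S → abstractᶠ Q boolᶠ (outSet b S) }

  init∈⁻ : ∀ p → memP (DTA.init projectA) p ≡ true → p ≡ init
  init∈⁻ p e = ⌊⌋≡true⁻ (_≟_ P p init) (trans (sym (apply-abstract P boolᶠ initSet p)) e)

  init∈⁺ : memP (DTA.init projectA) init ≡ true
  init∈⁺ = trans (apply-abstract P boolᶠ initSet init) (⌊⌋≡true⁺ (_≟_ P init init) refl)

  next∈⁻ : ∀ S T r → memP (DTA.next projectA S T) r ≡ true →
           ∃₂ λ p q → memP S p ≡ true × memQ T q ≡ true × next p q ≡ r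
  next∈⁻ S T r e =
    let p , e₁   = anyᶠ≡true⁻ P _ (trans (sym (apply-abstract P boolᶠ (nextSet S T) r)) e)
        p∈S , e₂ = ∧≡true⁻ e₁
        q , e₃   = anyᶠ≡true⁻ Q _ e₂
        q∈T , e₄ = ∧≡true⁻ e₃
    in p , q , p∈S , q∈T , ⌊⌋≡true⁻ (_≟_ P (next p q) r) e₄

  next∈⁺ : ∀ S T p q → memP S p ≡ true → memQ T q ≡ true → memP (DTA.next projectA S T) (next p q) ≡ true
  next∈⁺ S T p q p∈S q∈T =
    trans (apply-abstract P boolᶠ (nextSet S T) (next p q))
      (anyᶠ≡true⁺ P _ p (∧≡true⁺ p∈S (anyᶠ≡true⁺ Q _ q (∧≡true⁺ q∈T (⌊⌋≡true⁺ (_≟_ P (next p q) (next p q)) refl)))))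

  out∈⁻ : ∀ b S r → memQ (DTA.out projectA b S) r ≡ true →
          ∃₂ λ p bit → memP S p ≡ true × out (annotate b bit) p ≡ r
  out∈⁻ b S r e =
    let p , e₁   = anyᶠ≡true⁻ P _ (trans (sym (apply-abstract Q boolᶠ (outSet b S) r)) e)
        p∈S , e₂ = ∧≡true⁻ e₁
        bit , e₃ = anyᶠ≡true⁻ boolᶠ (λ bit → ⌊ _≟_ Q (out (annotate b bit) p) r ⌋) e₂
    in p , bit , p∈S , ⌊⌋≡true⁻ (_≟_ Q (out (annotate b bit) p) r) e₃

  out∈⁺ : ∀ b S p bit → memP S p ≡ true → memQ (DTA.out projectA b S) (out (annotate b bit) p) ≡ true
  out∈⁺ b S p bit p∈S =
    trans (apply-abstract Q boolᶠ (outSet b S) (out (annotate b bit) p))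
      (anyᶠ≡true⁺ P _ p (∧≡true⁺ p∈S (anyᶠ≡true⁺ boolᶠ (λ bit′ → ⌊ _≟_ Q (out (annotate b bit′) p) (out (annotate b bit) p) ⌋) bit (⌊⌋≡true⁺ (_≟_ Q _ _) refl))))

  annotateWith : ∀ {X : Set} → (X → B) → (X → Bool) → X → B'
  annotateWith f g x = annotate (f x) (g x)

  rootAndChildren : ∀ {k} {a : Fin k} {ts : List (Tree k)} →
                    Bool → ((j : Fin (length ts)) → Pos (Data.List.lookup ts j) → Bool) → Pos (node a ts) → Bool
  rootAndChildren bit G (_ , root)     = bit
  rootAndChildren bit G (_ , step i x) = G i (_ , x)

  module _ {k : ℕ} where

    projectA-complete : ∀ {t : Tree k} (O : Arrangement t) f g →
                        memQ (evaluate projectA O f) (evaluate A O (annotateWith f g)) ≡ true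
    projectA-complete (arrange perm Os) f g =
      out∈⁺ (f ([] , root)) (foldl (DTA.next projectA) (DTA.init projectA) (map childSet perm)) _ (g ([] , root))
        (fold perm (DTA.init projectA) init init∈⁺)
      where
      childSet = λ i → evaluate projectA (Os i) (f ∘ inChild i)

      fold : ∀ l S p → memP S p ≡ true →
             memP (foldl (DTA.next projectA) S (map childSet l))
                  (foldl next p (map (λ i → evaluate A (Os i) (annotateWith f g ∘ inChild i)) l)) ≡ true
      fold []      S p p∈S = p∈S
      fold (i ∷ l) S p p∈S =
        fold l _ _ (next∈⁺ S (childSet i) p _ p∈S (projectA-complete (Os i) (f ∘ inChild i) (g ∘ inChild i)))

    -- Each child's track is chosen independently; this needs every child to be read once.
    projectA-sound : ∀ {t : Tree k} (O : Arrangement t) → WellFormed O → ∀ f q → memQ (evaluate projectA O f) q ≡ true →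
                     ∃ λ (g : Pos t → Bool) → evaluate A O (annotateWith f g) ≡ q
    projectA-sound (arrange {ts = ts} perm Os) (u , _ , wf) f q e =
      let p , bit , p∈S , out≡ = out∈⁻ (f ([] , root)) (foldl (DTA.next projectA) (DTA.init projectA) (map childSet perm)) q e
          p₀ , p₀∈init , G , fold≡ = unfold perm u (DTA.init projectA) p p∈S
      in rootAndChildren bit G ,
         trans (cong (out (annotate (f _) bit)) (trans (cong (λ z → foldl next z (map (childState G) perm)) (sym (init∈⁻ p₀ p₀∈init))) fold≡)) out≡
      where
      Choice = (j : Fin (length ts)) → Pos (Data.List.lookup ts j) → Bool

      childSet : Fin (length ts) → El (℘ Q)
      childSet i = evaluate projectA (Os i) (f ∘ inChild i)

      childState : Choice → Fin (length ts) → El Q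
      childState G i = evaluate A (Os i) (annotateWith (f ∘ inChild i) (G i))

      unfold : ∀ l → Unique l → ∀ S r →
               memP (foldl (DTA.next projectA) S (map childSet l)) r ≡ true →
               ∃ λ p₀ → memP S p₀ ≡ true × Σ Choice λ G → foldl next p₀ (map (childState G) l) ≡ r
      unfold []      _           S r r∈ = r , r∈ , (λ _ _ → false) , refl
      unfold (i ∷ l) (i∉l ∷ u-l) S r r∈ =
        let p₁ , p₁∈ , G , fold≡   = unfold l u-l (DTA.next projectA S (childSet i)) r r∈
            p₀ , q , p₀∈ , q∈ , next≡ = next∈⁻ S (childSet i) p₁ p₁∈
            g , g≡                  = projectA-sound (Os i) (wf i) (f ∘ inChild i) q q∈
            unchanged : ∀ {j} → i ≢ j → childState (override G i g) j ≡ childState G j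
            unchanged {j} i≢j = evaluate-cong A (Os j) (λ x → cong (annotate (f (inChild j x))) (override-other G i g j i≢j x))
        in p₀ , p₀∈ , override G i g ,
           trans (cong₂ (λ z zs → foldl next (next p₀ z) zs)
                    (trans (evaluate-cong A (Os i) (λ x → cong (annotate (f (inChild i x))) (override-same G i g x))) g≡)
                    (map-cong-local (All.map unchanged i∉l)))
                 (trans (cong (λ z → foldl next z (map (childState G) l)) next≡) fold≡)

  someAccepted : (El Q → Bool) → El (℘ Q) → Bool
  someAccepted accept S = anyᶠ Q λ q → memQ S q ∧ accept q

  module _ {k : ℕ} (accept : El Q → Bool) where

    someAccepted-sound : ∀ {t : Tree k} (O : Arrangement t) → WellFormed O → ∀ f →
                         someAccepted accept (evaluate projectA O f) ≡ true →
                         ∃ λ (g : Pos t → Bool) → accept (evaluate A O (annotateWith f g)) ≡ true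
    someAccepted-sound O wf f e =
      let q , e₁ = anyᶠ≡true⁻ Q _ e
          q∈ , acc = ∧≡true⁻ e₁
          g , g≡ = projectA-sound O wf f q q∈
      in g , trans (cong accept g≡) acc

    someAccepted-complete : ∀ {t : Tree k} (O : Arrangement t) f (g : Pos t → Bool) →
                            accept (evaluate A O (annotateWith f g)) ≡ true → someAccepted accept (evaluate projectA O f) ≡ true
    someAccepted-complete O f g e = anyᶠ≡true⁺ Q _ _ (∧≡true⁺ (projectA-complete O f g) e)

-- From MSO formulas to automata

record Recognizer (B : Set) : Set₁ where
  field
    automaton : DTA B
    accept    : El (DTA.Q automaton) → Bool

open Recognizer

accepts : ∀ {k} {B : Set} (R : Recognizer B) {t : Tree k} → Arrangement t → (Pos t → B) → Bool
accepts R O f = accept R (evaluate (automaton R) O f)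

module _ {k : ℕ} {B : Set} (e : B → Bool) where

  existsA-correct : ∀ {t : Tree k} (O : Arrangement t) → WellFormed O → ∀ f →
                    evaluate (existsA e) O f ≡ true ⇔ ∃ λ (x : Pos t) → e (f x) ≡ true
  existsA-correct O wf f = mk⇔ (detects-sound (existsA-detects e) O f)
                              (λ (x , ex) → detects-complete (existsA-detects e) O wf f x ex)

-- Trees whose labels carry, besides the letter, one bit per free first-order and per free second-order variable.
module MSO (k : ℕ) where

  Letter : ℕ → ℕ → Set
  Letter n m = Fin k × Vec Bool n × Vec Bool m

  foBit : ∀ {n m} → Fin n → Letter n m → Bool
  foBit x (_ , bs , _) = Vec.lookup bs x

  soBit : ∀ {n m} → Fin m → Letter n m → Bool
  soBit X (_ , _ , Bs) = Vec.lookup Bs X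

  consFO : ∀ {n m} → Letter n m → Bool → Letter (suc n) m
  consFO (a , bs , Bs) b = a , b Vec.∷ bs , Bs

  consSO : ∀ {n m} → Letter n m → Bool → Letter n (suc m)
  consSO (a , bs , Bs) b = a , bs , b Vec.∷ Bs

  headFO : ∀ {n m} → Letter (suc n) m → Bool
  headFO (_ , bs , _) = Vec.head bs

  unannotated : Fin k → Letter 0 0
  unannotated a = a , Vec.[] , Vec.[]

  -- ∃x is compiled as ∃X with "X is a singleton", then the bit of X is projected away.
  compile : ∀ {n m} → Formula k n m → Recognizer (Letter n m)
  compile (lab a x)  = record { automaton = existsA (λ l → foBit x l ∧ ⌊ proj₁ l Fin.≟ a ⌋) ; accept = λ q → q }
  compile (desc x y) = record { automaton = descendantA (foBit x) (foBit y) ; accept = proj₂ }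
  compile (sib x y)  = record { automaton = siblingA (foBit x) (foBit y) ; accept = proj₂ ∘ proj₂ }
  compile (eq x y)   = record { automaton = existsA (λ l → foBit x l ∧ foBit y l) ; accept = λ q → q }
  compile (mem x X)  = record { automaton = existsA (λ l → foBit x l ∧ soBit X l) ; accept = λ q → q }
  compile (neg ψ)    = record { automaton = automaton (compile ψ) ; accept = not ∘ accept (compile ψ) }
  compile (conj ψ χ) = record
    { automaton = automaton (compile ψ) ⊗ automaton (compile χ)
    ; accept = λ (q , q′) → accept (compile ψ) q ∧ accept (compile χ) q′ }
  compile (ex₁ ψ)    = record
    { automaton = Projection.projectA (automaton (compile ψ) ⊗ singletonA headFO) consFO
    ; accept = Projection.someAccepted (automaton (compile ψ) ⊗ singletonA headFO) consFO
                 (λ (q , q′) → accept (compile ψ) q ∧ exactlyOne q′) }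
  compile (ex₂ ψ)    = record
    { automaton = Projection.projectA (automaton (compile ψ)) consSO
    ; accept = Projection.someAccepted (automaton (compile ψ)) consSO (accept (compile ψ)) }

  encode : ∀ {n m} {t : Tree k} → (Fin n → Pos t) → (Fin m → Pos t → Bool) → Pos t → Letter n m
  encode ρ σ x = label x , tabulate (λ i → ⌊ proj₁ x ≟ʷ proj₁ (ρ i) ⌋) , tabulate (λ X → σ X x)

  module _ {n m} {t : Tree k} (ρ : Fin n → Pos t) (σ : Fin m → Pos t → Bool) where

    foBit-encode⁻ : ∀ x p → foBit x (encode ρ σ p) ≡ true → p ≡ ρ x
    foBit-encode⁻ x p e = Pos-≡ p (ρ x) (⌊⌋≡true⁻ (proj₁ p ≟ʷ proj₁ (ρ x)) (trans (sym (Vec.lookup∘tabulate _ x)) e))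

    foBit-encode⁺ : ∀ x → foBit x (encode ρ σ (ρ x)) ≡ true
    foBit-encode⁺ x = trans (Vec.lookup∘tabulate _ x) (⌊⌋≡true⁺ (proj₁ (ρ x) ≟ʷ proj₁ (ρ x)) refl)

    soBit-encode : ∀ X p → soBit X (encode ρ σ p) ≡ σ X p
    soBit-encode X p = Vec.lookup∘tabulate _ X

  Correct : ∀ {n m} → Formula k n m → Set
  Correct {n} {m} ψ = ∀ {t : Tree k} (O : Arrangement t) (wf : WellFormed O) (ρ : Fin n → Pos t) (σ : Fin m → Pos t → Bool) →
    accepts (compile ψ) O (encode ρ σ) ≡ true ⇔ Sat t (arrangementOrder O wf) ψ ρ σ

  module _ {n m : ℕ} where

    lab-correct : ∀ a (x : Fin n) → Correct {n} {m} (lab a x)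
    lab-correct a x O wf ρ σ = ⇔.trans (existsA-correct _ O wf (encode ρ σ)) (mk⇔ to from)
      where
      to : (∃ λ p → foBit x (encode ρ σ p) ∧ ⌊ label p Fin.≟ a ⌋ ≡ true) → label (ρ x) ≡ a
      to (p , e) with ∧≡true⁻ e
      ... | at-x , labelled with refl ← foBit-encode⁻ ρ σ x p at-x = ⌊⌋≡true⁻ (label p Fin.≟ a) labelled
      from : label (ρ x) ≡ a → ∃ λ p → foBit x (encode ρ σ p) ∧ ⌊ label p Fin.≟ a ⌋ ≡ true
      from ρx-a = ρ x , ∧≡true⁺ (foBit-encode⁺ ρ σ x) (⌊⌋≡true⁺ (label (ρ x) Fin.≟ a) ρx-a)

    eq-correct : ∀ (x y : Fin n) → Correct {n} {m} (eq x y)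
    eq-correct x y O wf ρ σ = ⇔.trans (existsA-correct _ O wf (encode ρ σ)) (mk⇔ to from)
      where
      to : (∃ λ p → foBit x (encode ρ σ p) ∧ foBit y (encode ρ σ p) ≡ true) → proj₁ (ρ x) ≡ proj₁ (ρ y)
      to (p , e) = let at-x , at-y = ∧≡true⁻ e
                   in cong proj₁ (trans (sym (foBit-encode⁻ ρ σ x p at-x)) (foBit-encode⁻ ρ σ y p at-y))
      from : proj₁ (ρ x) ≡ proj₁ (ρ y) → ∃ λ p → foBit x (encode ρ σ p) ∧ foBit y (encode ρ σ p) ≡ true
      from x≡y = ρ x , ∧≡true⁺ (foBit-encode⁺ ρ σ x)
        (subst (λ z → foBit y (encode ρ σ z) ≡ true) (sym (Pos-≡ (ρ x) (ρ y) x≡y)) (foBit-encode⁺ ρ σ y))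

    mem-correct : ∀ (x : Fin n) (X : Fin m) → Correct (mem x X)
    mem-correct x X O wf ρ σ = ⇔.trans (existsA-correct _ O wf (encode ρ σ)) (mk⇔ to from)
      where
      to : (∃ λ p → foBit x (encode ρ σ p) ∧ soBit X (encode ρ σ p) ≡ true) → σ X (ρ x) ≡ true
      to (p , e) with ∧≡true⁻ e
      ... | at-x , in-X with refl ← foBit-encode⁻ ρ σ x p at-x = trans (sym (soBit-encode ρ σ X p)) in-X
      from : σ X (ρ x) ≡ true → ∃ λ p → foBit x (encode ρ σ p) ∧ soBit X (encode ρ σ p) ≡ true
      from in-X = ρ x , ∧≡true⁺ (foBit-encode⁺ ρ σ x) (trans (soBit-encode ρ σ X (ρ x)) in-X)

    desc-correct : ∀ (x y : Fin n) → Correct {n} {m} (desc x y)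
    desc-correct x y O wf ρ σ = mk⇔ to from
      where
      to : accepts (compile (desc x y)) O (encode ρ σ) ≡ true → ρ x ≺ ρ y
      to e with descendantA-sound (foBit x) (foBit y) O (encode ρ σ) e
      ... | p , q , p≺q , at-x , at-y with refl ← foBit-encode⁻ ρ σ x p at-x | refl ← foBit-encode⁻ ρ σ y q at-y = p≺q
      from : ρ x ≺ ρ y → accepts (compile (desc x y)) O (encode ρ σ) ≡ true
      from x≺y = descendantA-complete (foBit x) (foBit y) O wf (encode ρ σ) (ρ x) (ρ y) x≺y
                   (foBit-encode⁺ ρ σ x) (foBit-encode⁺ ρ σ y)

    sib-correct : ∀ (x y : Fin n) → Correct {n} {m} (sib x y)
    sib-correct x y O wf ρ σ = mk⇔ to from
      where
      to : accepts (compile (sib x y)) O (encode ρ σ) ≡ true → Earlier O (proj₂ (ρ x)) (proj₂ (ρ y))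
      to e with siblingA-sound (foBit x) (foBit y) O (encode ρ σ) e
      ... | p , q , p<q , at-x , at-y with refl ← foBit-encode⁻ ρ σ x p at-x | refl ← foBit-encode⁻ ρ σ y q at-y = p<q
      from : Earlier O (proj₂ (ρ x)) (proj₂ (ρ y)) → accepts (compile (sib x y)) O (encode ρ σ) ≡ true
      from x<y = siblingA-complete (foBit x) (foBit y) O wf (encode ρ σ) (proj₂ (ρ x)) (proj₂ (ρ y)) x<y
                   (foBit-encode⁺ ρ σ x) (foBit-encode⁺ ρ σ y)

    neg-correct : ∀ (ψ : Formula k n m) → Correct ψ → Correct (neg ψ)
    neg-correct ψ IH O wf ρ σ = mk⇔ to from
      where
      to : not (accepts (compile ψ) O (encode ρ σ)) ≡ true → ¬ Sat _ (arrangementOrder O wf) ψ ρ σ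
      to e s with accepts (compile ψ) O (encode ρ σ) | Equivalence.from (IH O wf ρ σ) s
      to () s | true | refl
      from : ¬ Sat _ (arrangementOrder O wf) ψ ρ σ → not (accepts (compile ψ) O (encode ρ σ)) ≡ true
      from ¬s with accepts (compile ψ) O (encode ρ σ) in acc
      ... | true  = ⊥-elim (¬s (Equivalence.to (IH O wf ρ σ) acc))
      ... | false = refl

    conj-correct : ∀ (ψ χ : Formula k n m) → Correct ψ → Correct χ → Correct (conj ψ χ)
    conj-correct ψ χ IHψ IHχ O wf ρ σ
      rewrite evaluate-⊗ (automaton (compile ψ)) (automaton (compile χ)) O (encode ρ σ) = mk⇔
        (λ e → let aψ , aχ = ∧≡true⁻ e in Equivalence.to (IHψ O wf ρ σ) aψ , Equivalence.to (IHχ O wf ρ σ) aχ)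
        (λ (sψ , sχ) → ∧≡true⁺ (Equivalence.from (IHψ O wf ρ σ) sψ) (Equivalence.from (IHχ O wf ρ σ) sχ))

    ex₂-correct : ∀ (ψ : Formula k n (suc m)) → Correct ψ → Correct (ex₂ ψ)
    ex₂-correct ψ IH O wf ρ σ = mk⇔
      (λ e → let g , acc = someAccepted-sound (accept (compile ψ)) O wf (encode ρ σ) e
             in g , Equivalence.to (IH O wf ρ (extend g σ)) acc)
      (λ (g , s) → someAccepted-complete (accept (compile ψ)) O (encode ρ σ) g (Equivalence.from (IH O wf ρ (extend g σ)) s))
      where open Projection (automaton (compile ψ)) consSO

    ex₁-correct : ∀ (ψ : Formula k (suc n) m) → Correct ψ → Correct (ex₁ ψ)
    ex₁-correct ψ IH {t} O wf ρ σ = mk⇔ to from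
      where
      A₁ = automaton (compile ψ) ⊗ singletonA headFO
      accept₁ = λ ((q , q′) : El (DTA.Q A₁)) → accept (compile ψ) q ∧ exactlyOne q′
      open Projection A₁ consFO

      split : ∀ (g : Pos t → Bool) → accept₁ (evaluate A₁ O (annotateWith (encode ρ σ) g)) ≡ true →
              accepts (compile ψ) O (annotateWith (encode ρ σ) g) ≡ true ×
              exactlyOne (evaluate (singletonA headFO) O (annotateWith (encode ρ σ) g)) ≡ true
      split g rewrite evaluate-⊗ (automaton (compile ψ)) (singletonA headFO) O (annotateWith (encode ρ σ) g) = ∧≡true⁻

      merge : ∀ (g : Pos t → Bool) → accepts (compile ψ) O (annotateWith (encode ρ σ) g) ≡ true →
              exactlyOne (evaluate (singletonA headFO) O (annotateWith (encode ρ σ) g)) ≡ true →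
              accept₁ (evaluate A₁ O (annotateWith (encode ρ σ) g)) ≡ true
      merge g rewrite evaluate-⊗ (automaton (compile ψ)) (singletonA headFO) O (annotateWith (encode ρ σ) g) = ∧≡true⁺

      -- guessing the track of {p} turns the encoding for ρ into the encoding for `extend p ρ`
      at : Pos t → Pos t → Bool
      at p x = ⌊ proj₁ x ≟ʷ proj₁ p ⌋

      singleton-track : ∀ (g : Pos t → Bool) p → g p ≡ true → (∀ q → g q ≡ true → proj₁ q ≡ proj₁ p) → ∀ x → g x ≡ at p x
      singleton-track g p gp unique x with g x in gx | proj₁ x ≟ʷ proj₁ p
      ... | true  | yes _   = refl
      ... | true  | no x≢p  = ⊥-elim (x≢p (unique x gx))
      ... | false | yes x≡p = trans (sym gx) (trans (cong g (Pos-≡ x p x≡p)) gp)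
      ... | false | no _    = refl

      to : someAccepted accept₁ (evaluate projectA O (encode ρ σ)) ≡ true → Sat t (arrangementOrder O wf) (ex₁ ψ) ρ σ
      to e =
        let g , acc = someAccepted-sound accept₁ O wf (encode ρ σ) e
            accψ , one = split g acc
            p , gp , unique = singletonA-sound headFO O wf (annotateWith (encode ρ σ) g) one
            track≡ = evaluate-cong (automaton (compile ψ)) O (λ x → cong (λ b → label x , b Vec.∷ _ , _) (singleton-track g p gp unique x))
        in p , Equivalence.to (IH O wf (extend p ρ) σ) (trans (cong (accept (compile ψ)) (sym track≡)) accψ)

      from : Sat t (arrangementOrder O wf) (ex₁ ψ) ρ σ → someAccepted accept₁ (evaluate projectA O (encode ρ σ)) ≡ true
      from (p , s) = someAccepted-complete accept₁ O (encode ρ σ) (at p)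
        (merge (at p) (Equivalence.from (IH O wf (extend p ρ) σ) s)
          (singletonA-complete headFO O wf _ p (⌊⌋≡true⁺ (proj₁ p ≟ʷ proj₁ p) refl) (λ q → ⌊⌋≡true⁻ (proj₁ q ≟ʷ proj₁ p))))

  compile-correct : ∀ {n m} (ψ : Formula k n m) → Correct ψ
  compile-correct (lab a x)  = lab-correct a x
  compile-correct (desc x y) = desc-correct x y
  compile-correct (sib x y)  = sib-correct x y
  compile-correct (eq x y)   = eq-correct x y
  compile-correct (mem x X)  = mem-correct x X
  compile-correct (neg ψ)    = neg-correct ψ (compile-correct ψ)
  compile-correct (conj ψ χ) = conj-correct ψ χ (compile-correct ψ) (compile-correct χ)
  compile-correct (ex₁ ψ)    = ex₁-correct ψ (compile-correct ψ)
  compile-correct (ex₂ ψ)    = ex₂-correct ψ (compile-correct ψ)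

-- Canonical arrangements

foldl-concatMap : ∀ {A X Y : Set} (f : A → Y → A) (g : X → List Y) p xs →
                  foldl f p (concatMap g xs) ≡ foldl (λ p x → foldl f p (g x)) p xs
foldl-concatMap f g p []       = refl
foldl-concatMap f g p (x ∷ xs) = trans (foldl-++ f p (g x) (concatMap g xs)) (foldl-concatMap f g _ xs)

foldl-↭ : ∀ {A X : Set} (f : A → X → A) → (∀ a x y → f (f a x) y ≡ f (f a y) x) →
          ∀ {xs ys} → xs ↭ ys → ∀ a → foldl f a xs ≡ foldl f a ys
foldl-↭ f comm ↭.refl           a = refl
foldl-↭ f comm (↭.prep x xs↭ys) a = foldl-↭ f comm xs↭ys (f a x)
foldl-↭ f comm (↭.swap x y xs↭ys) a rewrite comm a x y = foldl-↭ f comm xs↭ys _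
foldl-↭ f comm (↭.trans p q)    a = trans (foldl-↭ f comm p a) (foldl-↭ f comm q a)

module _ {n s : ℕ} (key : Fin n → Fin s) where

  ofClass : Fin s → List (Fin n)
  ofClass c = filter (λ i → key i Fin.≟ c) (allFin n)

  groupBy : List (Fin n)
  groupBy = concatMap ofClass (allFin s)

  ∈-groupBy : ∀ i → i ∈ groupBy
  ∈-groupBy i = ∈-concatMap⁺ ofClass (Any.map (λ { refl → ∈-filter⁺ (λ j → key j Fin.≟ key i) (∈-allFin i) refl }) (∈-allFin (key i)))

  groupBy-unique : Unique groupBy
  groupBy-unique = Unique.concat⁺ (All.map⁺ (All.universal (λ c → Unique.filter⁺ _ (Unique.allFin⁺ n)) (allFin s)))
    (AllPairs.map⁺ (AllPairs.map disjoint (Unique.allFin⁺ s)))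
    where
    disjoint : ∀ {c c′} → c ≢ c′ → Disjoint (ofClass c) (ofClass c′)
    disjoint {c} {c′} c≢c′ (i∈c , i∈c′) =
      c≢c′ (trans (sym (proj₂ (∈-filter⁻ (λ j → key j Fin.≟ c) {xs = allFin n} i∈c)))
                  (proj₂ (∈-filter⁻ (λ j → key j Fin.≟ c′) {xs = allFin n} i∈c′)))

-- Children are read class by class, where a child's class is its state under this very arrangement.
module Canonical {k : ℕ} {B : Set} (A : DTA B) (ℓ : Fin k → B) where
  open DTA A

  mutual
    canonical : (t : Tree k) → Arrangement t
    canonical (node a ts) = arrange (groupBy (index Q ∘ childState ts)) (canonicalAt ts)

    canonicalAt : (ts : List (Tree k)) (i : Fin (length ts)) → Arrangement (Data.List.lookup ts i)
    canonicalAt (t ∷ ts) zero    = canonical t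
    canonicalAt (t ∷ ts) (suc i) = canonicalAt ts i

    childState : (ts : List (Tree k)) → Fin (length ts) → El Q
    childState ts i = evaluate A (canonicalAt ts i) (ℓ ∘ label)

  mutual
    canonical-wellFormed : (t : Tree k) → WellFormed (canonical t)
    canonical-wellFormed (node a ts) =
      groupBy-unique (index Q ∘ childState ts) , ∈-groupBy (index Q ∘ childState ts) , canonicalAt-wellFormed ts

    canonicalAt-wellFormed : (ts : List (Tree k)) (i : Fin (length ts)) → WellFormed (canonicalAt ts i)
    canonicalAt-wellFormed (t ∷ ts) zero    = canonical-wellFormed t
    canonicalAt-wellFormed (t ∷ ts) (suc i) = canonicalAt-wellFormed ts i

  canonicalAt≡ : ∀ (ts : List (Tree k)) i → canonicalAt ts i ≡ canonical (Data.List.lookup ts i)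
  canonicalAt≡ (t ∷ ts) zero    = refl
  canonicalAt≡ (t ∷ ts) (suc i) = canonicalAt≡ ts i

  canonicalOrder : (t : Tree k) → SiblingOrder t
  canonicalOrder t = arrangementOrder (canonical t) (canonical-wellFormed t)

  state : Tree k → El Q
  state t = evaluate A (canonical t) (ℓ ∘ label)

  childState≡ : ∀ ts i → childState ts i ≡ state (Data.List.lookup ts i)
  childState≡ ts i = cong (λ O → evaluate A O (ℓ ∘ label)) (canonicalAt≡ ts i)

  Transformation : FinType
  Transformation = P ⇒ᶠ P

  transform : El Transformation → El P → El P
  transform = apply P P

  identity : El Transformation
  identity = abstractᶠ P P (λ p → p)

  transform-identity : ∀ p → transform identity p ≡ p
  transform-identity = apply-abstract P P (λ p → p)

  thenRead : El Q → El Transformation → El Transformation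
  thenRead q = Vec.map (λ p → next p q)

  transform-thenRead : ∀ q h p → transform (thenRead q h) p ≡ next (transform h p) q
  transform-thenRead q h p = Vec.lookup-map (index P p) _ h

  -- Maps each state q to the composite of the transitions read so far for the children in state q.
  Accumulator : FinType
  Accumulator = Q ⇒ᶠ Transformation

  start : El Accumulator
  start = Vec.replicate _ identity

  read : El Accumulator → El Q → El Accumulator
  read H q = Vec.updateAt H (index Q q) (thenRead q)

  read-comm : ∀ H q q′ → read (read H q) q′ ≡ read (read H q′) q
  read-comm H q q′ with index Q q Fin.≟ index Q q′
  ... | yes same with refl ← index-injective Q same = refl
  ... | no differ = Vec.updateAt-commutes (index Q q′) (index Q q) (differ ∘ sym) H

  finish : Fin k → El Accumulator → El Q
  finish a H = out (ℓ a) (foldl (λ p c → transform (Vec.lookup H c) p) init (allFin (size Q)))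

  transform-foldl-read : ∀ {I : Set} (h : I → El Q) (l : List I) H c p →
    transform (Vec.lookup (foldl read H (map h l)) c) p
      ≡ foldl next (transform (Vec.lookup H c) p) (map h (filter (λ i → index Q (h i) Fin.≟ c) l))
  transform-foldl-read h []      H c p = refl
  transform-foldl-read h (i ∷ l) H c p with index Q (h i) Fin.≟ c
  ... | yes refl = trans (transform-foldl-read h l (read H (h i)) c p)
                         (cong (λ z → foldl next z rest) (trans (cong (λ T → transform T p) (Vec.lookup∘updateAt c {thenRead (h i)} H))
                                                               (transform-thenRead (h i) (Vec.lookup H c) p)))
    where rest = map h (filter (λ j → index Q (h j) Fin.≟ c) l)
  ... | no i∉c  = trans (transform-foldl-read h l (read H (h i)) c p)
                        (cong (λ T → foldl next (transform T p) rest) (Vec.lookup∘updateAt′ c (index Q (h i)) {thenRead (h i)} (i∉c ∘ sym) H))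
    where rest = map h (filter (λ j → index Q (h j) Fin.≟ c) l)

  state-node : ∀ a (ts : List (Tree k)) →
               state (node a ts) ≡ finish a (foldl read start (map (childState ts) (allFin (length ts))))
  state-node a ts = cong (out (ℓ a)) (sym (begin
      foldl (λ p c → transform (Vec.lookup accumulated c) p) init (allFin (size Q))
        ≡⟨ foldl-cong (λ p c → trans (transform-foldl-read (childState ts) (allFin n) start c p)
                                     (cong (λ z → foldl next z (map (childState ts) (ofClass key c)))
                                           (trans (cong (λ T → transform T p) (Vec.lookup-replicate c identity)) (transform-identity p))))
                      init (allFin (size Q)) ⟩
      foldl (λ p c → foldl next p (map (childState ts) (ofClass key c))) init (allFin (size Q))
        ≡⟨ foldl-concatMap next (map (childState ts) ∘ ofClass key) init (allFin (size Q)) ⟨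
      foldl next init (concatMap (map (childState ts) ∘ ofClass key) (allFin (size Q)))
        ≡⟨ cong (foldl next init) (map-concatMap (childState ts) (ofClass key) (allFin (size Q))) ⟨
      foldl next init (map (childState ts) (groupBy key)) ∎))
    where
    open ≡-Reasoning
    n = length ts
    key = index Q ∘ childState ts
    accumulated = foldl read start (map (childState ts) (allFin n))

module _ {k : ℕ} where

  rootLabel : Tree k → Fin k
  rootLabel (node a _) = a

  children : Tree k → List (Tree k)
  children (node _ ts) = ts

  subtreeAt : ∀ {t : Tree k} {w} → w ∈D t → Tree k
  subtreeAt (root {a} {ts}) = node a ts
  subtreeAt (step i p)      = subtreeAt p

  subtree : ∀ {t : Tree k} → Pos t → Tree k
  subtree = subtreeAt ∘ proj₂

  subtreeAt-root∈ : (t : Tree k) → subtreeAt (root∈ t) ≡ t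
  subtreeAt-root∈ (node a ts) = refl

  subtree-rootPos : (t : Tree k) → subtree (rootPos t) ≡ t
  subtree-rootPos (node a ts) = refl

  labelAt≡rootLabel : ∀ {t : Tree k} {w} (p : w ∈D t) → labelAt p ≡ rootLabel (subtreeAt p)
  labelAt≡rootLabel root       = refl
  labelAt≡rootLabel (step i p) = labelAt≡rootLabel p

  childAt∈ : ∀ {t : Tree k} {w} (p : w ∈D t) (i : Fin (length (children (subtreeAt p)))) → (w ++ [ suc (toℕ i) ]) ∈D t
  childAt∈ (root {a} {ts}) i = step i (root∈ (Data.List.lookup ts i))
  childAt∈ (step j p)      i = step j (childAt∈ p i)

  subtreeAt-childAt : ∀ {t : Tree k} {w} (p : w ∈D t) i → subtreeAt (childAt∈ p i) ≡ Data.List.lookup (children (subtreeAt p)) i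
  subtreeAt-childAt (root {a} {ts}) i = subtreeAt-root∈ (Data.List.lookup ts i)
  subtreeAt-childAt (step j p)      i = subtreeAt-childAt p i

  childPos : ∀ {t : Tree k} (s : Pos t) → Fin (length (children (subtree s))) → Pos t
  childPos (w , p) i = w ++ [ suc (toℕ i) ] , childAt∈ p i

  childPositions : ∀ {t : Tree k} → Pos t → List (Pos t)
  childPositions s = map (childPos s) (allFin _)

  subtree-childPos : ∀ {t : Tree k} (s : Pos t) i → subtree (childPos s i) ≡ Data.List.lookup (children (subtree s)) i
  subtree-childPos (w , p) i = subtreeAt-childAt p i

  childPos-isChild : ∀ {t : Tree k} (s : Pos t) i → IsChild s (childPos s i)
  childPos-isChild s i = suc (toℕ i) , refl

  child-index : ∀ {t : Tree k} {w v c} (p : w ∈D t) (q : v ∈D t) → v ≡ w ++ [ c ] →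
                ∃ λ (i : Fin (length (children (subtreeAt p)))) → c ≡ suc (toℕ i)
  child-index root       (step i q)  e with refl ← ∷-injectiveˡ e = i , refl
  child-index (step j p) (step j′ q) e with Fin.toℕ-injective (suc-injective (∷-injectiveˡ e))
  ... | refl = child-index p q (∷-injectiveʳ e)

  isChild⇒∈childPositions : ∀ {t : Tree k} (s y : Pos t) → IsChild s y → y ∈ childPositions s
  isChild⇒∈childPositions s y (c , e) with child-index (proj₂ s) (proj₂ y) e
  ... | i , refl = subst (_∈ childPositions s) (sym (Pos-≡ y (childPos s i) e)) (∈-map⁺ (childPos s) (∈-allFin i))

  childPos-injective : ∀ {t : Tree k} (s : Pos t) {i j} → proj₁ (childPos s i) ≡ proj₁ (childPos s j) → i ≡ j
  childPos-injective s e = Fin.toℕ-injective (suc-injective (∷-injectiveˡ (++-cancelˡ (proj₁ s) _ _ e)))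

  childPositions-unique : ∀ {t : Tree k} (s : Pos t) → Unique (childPositions s)
  childPositions-unique s = Unique.map⁺ (childPos-injective s ∘ cong proj₁) (Unique.allFin⁺ _)

  children-transport : ∀ {T T′ : Tree k} → T ≡ T′ → (i : Fin (length (children T))) →
                       ∃ λ (j : Fin (length (children T′))) → Data.List.lookup (children T) i ≡ Data.List.lookup (children T′) j
  children-transport refl i = i , refl

module InsertionSort {k : ℕ} {t : Tree k} (so : SiblingOrder t) where
  open SiblingOrder so using (_⋖_; ⋖-dec; siblings; total)

  insert : Pos t → List (Pos t) → List (Pos t)
  insert x []      = [ x ]
  insert x (y ∷ l) with ⋖-dec x y
  ... | yes _ = x ∷ y ∷ l
  ... | no _  = y ∷ insert x l

  sort : List (Pos t) → List (Pos t)
  sort = foldr insert []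

  ∈-insert⁻ : ∀ x l {z} → z ∈ insert x l → z ≡ x ⊎ z ∈ l
  ∈-insert⁻ x []      (here e) = inj₁ e
  ∈-insert⁻ x (y ∷ l) z∈ with ⋖-dec x y
  ∈-insert⁻ x (y ∷ l) (here e)  | yes _ = inj₁ e
  ∈-insert⁻ x (y ∷ l) (there m) | yes _ = inj₂ m
  ∈-insert⁻ x (y ∷ l) (here e)  | no _  = inj₂ (here e)
  ∈-insert⁻ x (y ∷ l) (there m) | no _  with ∈-insert⁻ x l m
  ... | inj₁ e  = inj₁ e
  ... | inj₂ m′ = inj₂ (there m′)

  ∈-insertˡ : ∀ x l → x ∈ insert x l
  ∈-insertˡ x []      = here refl
  ∈-insertˡ x (y ∷ l) with ⋖-dec x y
  ... | yes _ = here refl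
  ... | no _  = there (∈-insertˡ x l)

  ∈-insertʳ : ∀ x l {z} → z ∈ l → z ∈ insert x l
  ∈-insertʳ x (y ∷ l) m with ⋖-dec x y
  ∈-insertʳ x (y ∷ l) m         | yes _ = there m
  ∈-insertʳ x (y ∷ l) (here e)  | no _  = here e
  ∈-insertʳ x (y ∷ l) (there m) | no _  = there (∈-insertʳ x l m)

  ∈-sort⁻ : ∀ l {z} → z ∈ sort l → z ∈ l
  ∈-sort⁻ (x ∷ l) m with ∈-insert⁻ x (sort l) m
  ... | inj₁ e  = here e
  ... | inj₂ m′ = there (∈-sort⁻ l m′)

  ∈-sort⁺ : ∀ l {z} → z ∈ l → z ∈ sort l
  ∈-sort⁺ (x ∷ l) (here refl) = ∈-insertˡ x (sort l)
  ∈-sort⁺ (x ∷ l) (there m)   = ∈-insertʳ x (sort l) (∈-sort⁺ l m)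

  Comparable : Pos t → Pos t → Set
  Comparable a b = a ⋖ b ⊎ b ⋖ a

  All-insert : ∀ {P : Pos t → Set} x l → P x → All P l → All P (insert x l)
  All-insert x []      px []         = px ∷ []
  All-insert x (y ∷ l) px (py ∷ pl) with ⋖-dec x y
  ... | yes _ = px ∷ py ∷ pl
  ... | no _  = py ∷ All-insert x l px pl

  insert-sorted : ∀ x l → All (Comparable x) l → AllPairs _⋖_ l → AllPairs _⋖_ (insert x l)
  insert-sorted x []      _          _          = [] ∷ []
  insert-sorted x (y ∷ l) (cy ∷ cl) (y< ∷ sl) with ⋖-dec x y
  ... | yes x⋖y = (x⋖y ∷ All.map (SiblingOrder.trans so x y _ x⋖y) y<) ∷ y< ∷ sl
  ... | no ¬x⋖y with cy
  ...   | inj₁ x⋖y = ⊥-elim (¬x⋖y x⋖y)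
  ...   | inj₂ y⋖x = All-insert x l y⋖x y< ∷ insert-sorted x l cl sl

  sort-sorted : ∀ l → AllPairs Comparable l → AllPairs _⋖_ (sort l)
  sort-sorted []      _         = []
  sort-sorted (x ∷ l) (cx ∷ cl) =
    insert-sorted x (sort l) (All.tabulate (λ m → All.lookup cx (∈-sort⁻ l m))) (sort-sorted l cl)

  ⋖⇒≢ : ∀ {a b} → a ⋖ b → proj₁ a ≢ proj₁ b
  ⋖⇒≢ {a} {b} a⋖b e with siblings a b a⋖b
  ... | s , i , j , e₁ , e₂ , i≢j = i≢j (proj₂ (∷ʳ-injective s s (trans (sym e₁) (trans e e₂))))

  childPositions-comparable : ∀ s → AllPairs Comparable (childPositions s)
  childPositions-comparable s = AllPairs.map⁺ (AllPairs.map comparable (Unique.allFin⁺ _))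
    where
    comparable : ∀ {i j} → i ≢ j → Comparable (childPos s i) (childPos s j)
    comparable i≢j = total s _ _ (childPos-isChild s _) (childPos-isChild s _) (i≢j ∘ childPos-injective s)

  sortedChildren : Pos t → List (Pos t)
  sortedChildren s = sort (childPositions s)

  sortedChildren-inOrder : ∀ s → ChildrenInOrder so s (sortedChildren s)
  sortedChildren-inOrder s = isChild , complete′ , AllPairs⇒Linked (sort-sorted (childPositions s) (childPositions-comparable s))
    where
    isChild : ∀ c → Any (λ d → d ≡ c) (sortedChildren s) → IsChild s c
    isChild c m with ∈-map⁻ (childPos s) (∈-sort⁻ (childPositions s) (Any.map sym m))
    ... | i , _ , refl = childPos-isChild s i
    complete′ : ∀ y → IsChild s y → Any (λ d → proj₁ d ≡ proj₁ y) (sortedChildren s)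
    complete′ y y-child = Any.map (λ e → cong proj₁ (sym e)) (∈-sort⁺ (childPositions s) (isChild⇒∈childPositions s y y-child))

-- Simulating canonical arrangements by an order-invariant automaton

module OrderInvariant {k : ℕ} {B : Set} (A : DTA B) (ℓ : Fin k → B) (acceptA : El (DTA.Q A) → Bool) where
  open DTA A using (Q)
  open Canonical A ℓ

  horizontal : Fin (size Q) → Fin k → DFA (size Q)
  horizontal c a = record
    { nStates = size Accumulator
    ; start   = index Accumulator start
    ; accept  = λ s → ⌊ index Q (finish a (element Accumulator s)) Fin.≟ c ⌋
    ; next    = λ s q → index Accumulator (read (element Accumulator s) (element Q q)) }

  automatonN : TreeAutomaton k
  automatonN = record { nQ = size Q ; final = acceptA ∘ element Q ; δ = horizontal }

  foldl-horizontal : ∀ c a w s → element Accumulator (foldl (DFA.next (horizontal c a)) s w)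
                                 ≡ foldl read (element Accumulator s) (map (element Q) w)
  foldl-horizontal c a []      s = refl
  foldl-horizontal c a (q ∷ w) s =
    trans (foldl-horizontal c a w _) (cong (λ H → foldl read H (map (element Q) w)) (element-index Accumulator _))

  ∈L-horizontal : ∀ c a w → w ∈L horizontal c a ⇔ index Q (finish a (foldl read start (map (element Q) w))) ≡ c
  ∈L-horizontal c a w = mk⇔ (λ m → trans (sym (reached≡)) (⌊⌋≡true⁻ (_ Fin.≟ c) m))
                            (λ e → ⌊⌋≡true⁺ (_ Fin.≟ c) (trans reached≡ e))
    where
    reached≡ : index Q (finish a (element Accumulator (foldl (DFA.next (horizontal c a)) (DFA.start (horizontal c a)) w)))
               ≡ index Q (finish a (foldl read start (map (element Q) w)))
    reached≡ = cong (λ H → index Q (finish a H))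
                    (trans (foldl-horizontal c a w _) (cong (λ H → foldl read H (map (element Q) w)) (element-index Accumulator start)))

  deterministic : Deterministic automatonN
  deterministic q q′ a q≢q′ w (m , m′) =
    q≢q′ (trans (sym (Equivalence.to (∈L-horizontal q a w) m)) (Equivalence.to (∈L-horizontal q′ a w) m′))

  invariant : ⋖-Invariant automatonN
  invariant q a w w′ w↭w′ m = Equivalence.from (∈L-horizontal q a w′)
    (trans (cong (λ H → index Q (finish a H)) (sym (foldl-↭ read read-comm (↭.map⁺ (element Q) w↭w′) start)))
           (Equivalence.to (∈L-horizontal q a w) m))

  state-children : ∀ (T : Tree k) → state T ≡ finish (rootLabel T)
    (foldl read start (map (childState (children T)) (allFin (length (children T)))))
  state-children (node a ts) = state-node a ts

  module _ {t : Tree k} (so : SiblingOrder t) where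

    inOrder-↭ : ∀ s cs → ChildrenInOrder so s cs → cs ↭ childPositions s
    inOrder-↭ s cs (cs⊆ , ⊆cs , linked) = ∼bag⇒↭ (unique∧set⇒bag cs-unique (childPositions-unique s) (mk⇔ to from))
      where
      cs-unique : Unique cs
      cs-unique = AllPairs.map (λ a⋖b a≡b → InsertionSort.⋖⇒≢ so a⋖b (cong proj₁ a≡b))
                               (Linked⇒AllPairs (SiblingOrder.trans so _ _ _) linked)
      to : ∀ {x} → x ∈ cs → x ∈ childPositions s
      to {x} m = isChild⇒∈childPositions s x (cs⊆ x (Any.map sym m))
      from : ∀ {x} → x ∈ childPositions s → x ∈ cs
      from m with ∈-map⁻ (childPos _) m
      ... | i , _ , refl = Any.map (λ e → sym (Pos-≡ _ _ e)) (⊆cs (childPos s i) (childPos-isChild s i))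

    finish-inOrder : ∀ s cs → ChildrenInOrder so s cs →
                     finish (label s) (foldl read start (map (state ∘ subtree) cs)) ≡ state (subtree s)
    finish-inOrder s cs in-order = begin
        finish (label s) (foldl read start (map (state ∘ subtree) cs))
          ≡⟨ cong₂ finish (labelAt≡rootLabel (proj₂ s)) (foldl-↭ read read-comm (↭.map⁺ (state ∘ subtree) (inOrder-↭ s cs in-order)) start) ⟩
        finish (rootLabel T) (foldl read start (map (state ∘ subtree) (map (childPos s) (allFin n))))
          ≡⟨ cong (λ z → finish (rootLabel T) (foldl read start z))
                  (trans (sym (map-∘ (allFin n))) (map-cong (λ i → trans (cong state (subtree-childPos s i)) (sym (childState≡ (children T) i))) (allFin n))) ⟩
        finish (rootLabel T) (foldl read start (map (childState (children T)) (allFin n)))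
          ≡⟨ state-children T ⟨
        state T ∎
      where
      open ≡-Reasoning
      T = subtree s
      n = length (children T)

  canonicalRun : ∀ {t : Tree k} → Pos t → Fin (size Q)
  canonicalRun = index Q ∘ state ∘ subtree

  canonicalRun-isRun : ∀ {t : Tree k} (so : SiblingOrder t) → IsRun automatonN t so canonicalRun
  canonicalRun-isRun so s cs in-order = Equivalence.from (∈L-horizontal (canonicalRun s) (label s) (map canonicalRun cs))
    (cong (index Q) (trans (cong (λ z → finish (label s) (foldl read start z))
                                 (trans (sym (map-∘ cs)) (map-cong (λ x → element-index Q (state (subtree x))) cs)))
                           (finish-inOrder so s cs in-order)))

  -- The arrangement is only a measure for the induction over the subtree at x.
  run-unique : ∀ {t : Tree k} (so : SiblingOrder t) (ρ : Pos t → Fin (size Q)) → IsRun automatonN t so ρ →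
               ∀ {T} (O : Arrangement T) (x : Pos t) → subtree x ≡ T → ρ x ≡ index Q (state T)
  run-unique so ρ run (arrange perm Os) x x↦T =
    trans (sym (Equivalence.to (∈L-horizontal (ρ x) (label x) (map ρ cs)) (run x cs (sortedChildren-inOrder x))))
      (cong (index Q) (trans (cong (λ z → finish (label x) (foldl read start z)) (trans (sym (map-∘ cs)) (map-cong-local children-agree)))
                             (trans (finish-inOrder so x cs (sortedChildren-inOrder x)) (cong state x↦T))))
    where
    open InsertionSort so
    cs = sortedChildren x

    child-agrees : ∀ c → c ∈ childPositions x → element Q (ρ c) ≡ state (subtree c)
    child-agrees c m with ∈-map⁻ (childPos _) m
    ... | i , _ , refl with children-transport x↦T i
    ...   | j , i↦j = trans (cong (element Q) (run-unique so ρ run (Os j) (childPos x i) (trans (subtree-childPos x i) i↦j)))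
                            (trans (element-index Q _) (cong state (sym (trans (subtree-childPos x i) i↦j))))

    children-agree : All (λ c → element Q (ρ c) ≡ state (subtree c)) cs
    children-agree = All.tabulate (λ m → child-agrees _ (∈-sort⁻ (childPositions x) m))

  accepts⇔ : ∀ (t : Tree k) (so : SiblingOrder t) → Accepts automatonN t so ⇔ acceptA (state t) ≡ true
  accepts⇔ t so = mk⇔
    (λ (ρ , run , final) → trans (cong acceptA (sym (trans (cong (element Q) (run-unique so ρ run (canonical t) (rootPos t) (subtree-rootPos t)))
                                                          (element-index Q _)))) final)
    (λ acc → canonicalRun , canonicalRun-isRun so ,
             trans (cong acceptA (element-index Q _)) (trans (cong (acceptA ∘ state) (subtree-rootPos t)) acc))

module FromSentence (k : ℕ) (φ : Sentence k) where
  open MSO k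

  R = compile φ
  open Canonical (automaton R) unannotated public
  open OrderInvariant (automaton R) unannotated (accept R) public

  accept-canonical⇔ : (t : Tree k) → accept R (state t) ≡ true ⇔ t , canonicalOrder t ⊨ φ
  accept-canonical⇔ t = compile-correct φ (canonical t) (canonical-wellFormed t) (λ ()) (λ ())

  definedBy⇔ : SiblingOrderInvariant φ → (t : Tree k) → DefinedBy φ t ⇔ accept R (state t) ≡ true
  definedBy⇔ inv t = mk⇔
    (λ (so , sat) → Equivalence.from (accept-canonical⇔ t) (proj₁ (inv t so (canonicalOrder t)) sat))
    (λ acc → canonicalOrder t , Equivalence.to (accept-canonical⇔ t) acc)

lemma5 : (k : ℕ) (φ : Sentence k) → SiblingOrderInvariant φ →
  Σ (TreeAutomaton k) λ N →
    Deterministic N × ⋖-Invariant N ×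
    ((t : Tree k) →
      (DefinedBy φ t ⇔ Σ (SiblingOrder t) (λ so → Accepts N t so)) ×
      (DefinedBy φ t ⇔ ((so : SiblingOrder t) → Accepts N t so)))
lemma5 k φ inv = automatonN , deterministic , invariant , λ t →
  ⇔.trans (definedBy⇔ inv t) (mk⇔ (λ acc → canonicalOrder t , Equivalence.from (accepts⇔ t (canonicalOrder t)) acc)
                                  (λ (so , acc) → Equivalence.to (accepts⇔ t so) acc)) ,
  ⇔.trans (definedBy⇔ inv t) (mk⇔ (λ acc so → Equivalence.from (accepts⇔ t so) acc)
                                  (λ acc → Equivalence.to (accepts⇔ t (canonicalOrder t)) (acc (canonicalOrder t))))
  where open FromSentence k φ
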